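{- Let $p>2$ be a prime, let $t$ be a positive divisor of $p-1$, let $k$ be an integer with $1<k<p/2$, let $a\in\mathbb{F}_p^*$ and let $x_0\in U(k,t,a)$. Put $r_0(k)=\left\lfloor \frac{\log(p/2)}{\log k}\right\rfloor$ and $s=s_0(k,t)=\max\left\{s'\in\mathbb{Z}_{\ge 0}~:~\binom{r_0(k)+s'}{s'}\le t\right\}$. Then $$\#\{|x|~:~x\in U(k,t,a),\ (x,x_0)=1\}\le\Psi(k,p_{s}).$$
   Context: $\mathbb{F}_p$ is the field of residues modulo $p$, $\mathbb{F}_p^*=\mathbb{F}_p\setminus\{0\}$. For $x\in\mathbb{F}_p$ its integer height is $|x|=\min\{|a|~:~a\in\mathbb{Z},\ a\equiv x \pmod p\}$; elements of $\mathbb{F}_p$ of integer height $<p/2$ are identified with their integer representative of minimal absolute value, and $(x,x_0)$ denotes the greatest common divisor of these integer representatives. For $t\mid p-1$, $G$ is the unique subgroup of $\mathbb{F}_p^*$ of order $t$, $aG=\{ag~:~g\in G\}$, and $U(k,t,a)=\{x\in aG~:~|x|\le k\}$. $\Psi(x,y)$ is the number of positive integers $n\le x$ all of whose prime factors are at most $y$. $p_j$ is the $j$-th prime ($p_1=2$); by convention $p_0$-smooth integers are those with no prime factors, so $\Psi(x,p_0)=1$ for $x\ge1$. -}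

module Defs where

open import Data.Bool using (Bool; true; false; _∧_; _∨_; not; T)
open import Data.Nat using (ℕ; zero; suc; _+_; _*_; _∸_; _^_; _≤_; _<_; _≤ᵇ_; _≡ᵇ_; _⊓_; NonZero; _%_; _!)
open import Data.Nat.Properties using (_≟_)
open import Data.Nat.GCD using (gcd)
open import Data.Nat.Divisibility using (_∣?_)
open import Data.Nat.Primality using (prime?)
open import Data.List using (List; upTo; map; filterᵇ; length; deduplicate)
open import Data.Bool.ListAction using (all; any)
open import Relation.Nullary.Decidable using (⌊_⌋; yes; no)

-- Elements of F_p are represented by their residues 0,1,…,p-1 (natural numbers < p).

-- Integer height |x| = min { |a| : a ≡ x (mod p) }.
height : (p : ℕ) → .{{NonZero p}} → ℕ → ℕ
height p x = (x % p) ⊓ (p ∸ (x % p))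

-- Membership in the coset aG, where G = { g ∈ F_p : g^t = 1 } is the
-- (unique) subgroup of F_p^* of order t (t ∣ p-1):  x ∈ aG iff x = a·g for some g ∈ G.
inAGᵇ : (p : ℕ) → .{{NonZero p}} → (t a x : ℕ) → Bool
inAGᵇ p t a x = any (λ g → ((g ^ t) % p ≡ᵇ 1) ∧ (((a * g) % p) ≡ᵇ (x % p))) (upTo p)

inUᵇ : (p : ℕ) → .{{NonZero p}} → (k t a x : ℕ) → Bool
inUᵇ p k t a x = inAGᵇ p t a x ∧ (height p x ≤ᵇ k)

-- For |x|,|x0| < p/2 the integer representatives of minimal absolute value
-- have absolute values |x|, |x0|, so their gcd is gcd(|x|,|x0|).
coprimeHeights : (p : ℕ) → .{{NonZero p}} → (k t a x0 : ℕ) → List ℕ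
coprimeHeights p k t a x0 =
  deduplicate _≟_
    (map (height p)
      (filterᵇ (λ x → inUᵇ p k t a x ∧ (gcd (height p x) (height p x0) ≡ᵇ 1)) (upTo p)))

-- n is y-smooth: every prime factor q of n satisfies q ≤ y
-- (for n ≥ 1 all prime factors are ≤ n, so checking q ≤ n suffices).
smoothᵇ : ℕ → ℕ → Bool
smoothᵇ y n = all (λ q → not (⌊ prime? q ⌋ ∧ ⌊ q ∣? n ⌋) ∨ (q ≤ᵇ y)) (upTo (suc n))

Ψ : ℕ → ℕ → ℕ
Ψ x y = length (filterᵇ (smoothᵇ y) (map suc (upTo x)))

-- first prime among n, n+1, …, n+f-1 (returns n+f if none, never happens below).
findPrime : ℕ → ℕ → ℕ
findPrime zero n = n
findPrime (suc f) n with prime? n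
... | yes _ = n
... | no _ = findPrime f (suc n)

-- p_j, the j-th prime (p_1 = 2).  Convention p_0 = 1, so that "p_0-smooth"
-- means "no prime factors" (Ψ(x,p_0) = 1 for x ≥ 1), as in the paper.
-- The next prime after m lies in (m, m! + 1], so fuel m! suffices.
nthPrime : ℕ → ℕ
nthPrime zero = 1
nthPrime (suc j) = findPrime (nthPrime j !) (suc (nthPrime j))

-- Let H be the set of heights in question and view each h ∈ H through its valuations at the primes
-- q ≤ k. Gaussian elimination on these valuation vectors leaves two cases. Either the valuations at
-- some s primes already determine h ∈ H; then moving these exponents onto p₁, …, p_s maps H injectively
-- into the p_s-smooth numbers ≤ k, so #H ≤ Ψ(k, p_s). Or some h₁, …, h_{s+1} ∈ H have independent
-- valuation vectors. Then, with D = r₀ and h₀ = |x₀|, the products h₀^e₀ h₁^e₁ ⋯ h_{s+1}^e_{s+1} of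
-- total degree D are pairwise distinct (by independence and since gcd(h_i, h₀) = 1) and at most
-- k^D ≤ p/2, while each of them is ± a^D times an element of G. Numbers in [0, p/2) that agree up to
-- sign mod p are equal, so X^t − 1 gets C(D+s+1, s+1) distinct roots mod p: C(r₀+s+1, s+1) ≤ t,
-- contradicting the maximality of s.

module Submission where

module Modular where

  open import Data.Nat.Base as ℕ using (ℕ; zero; suc; NonZero; _≤_; _<_)
  import Data.Nat.Properties as ℕ
  import Data.Nat.Divisibility as ℕ
  open import Data.Nat.DivMod using (_%_; _/_; m≡m%n+[m/n]*n; %-distribˡ-*)
  open import Data.Nat.Primality using (Prime; euclidsLemma)
  open import Data.Integer.Base using (ℤ; +_; _+_; _*_; _-_; -_; _◃_)
    renaming (∣_∣ to abs)
  import Data.Integer.Properties as ℤ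
  open import Data.Integer.Divisibility.Signed
    using (_∣_; divides; ∣ᵤ⇒∣; ∣⇒∣ᵤ; ∣m∣n⇒∣m+n; ∣n⇒∣m*n; ∣m⇒∣m*n; ∣m⇒∣-m)
  open import Data.Integer.Tactic.RingSolver using (solve-∀)
  open import Data.Sign.Base as Sign using (Sign)
  import Data.Sign.Properties as Sign
  open import Data.Empty using (⊥-elim)
  open import Data.Sum.Base using (_⊎_)
  import Data.Sum.Base as Sum
  open import Data.Product.Base using (∃; _,_)
  open import Relation.Binary.PropositionalEquality
  open import Level using (0ℓ)
  open import Relation.Binary.Bundles using (Setoid)
  import Relation.Binary.Reasoning.Setoid as SetoidReasoning

  prime∣*⇒∣⊎∣ : ∀ {p} → Prime p → ∀ a b → + p ∣ a * b → + p ∣ a ⊎ + p ∣ b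
  prime∣*⇒∣⊎∣ {p} p-prime a b p∣ab =
    Sum.map ∣ᵤ⇒∣ ∣ᵤ⇒∣ (euclidsLemma _ _ p-prime (subst (p ℕ.∣_) (ℤ.abs-* a b) (∣⇒∣ᵤ p∣ab)))

  infix 4 _≡_mod_

  record _≡_mod_ (a b : ℤ) (p : ℕ) : Set where
    constructor divides-difference
    field p∣a-b : + p ∣ a - b
  open _≡_mod_ public

  private
    ∣-resp-≡ : ∀ {p a b} → a ≡ b → + p ∣ a → + p ∣ b
    ∣-resp-≡ refl d = d

  module _ {p : ℕ} where

    ≡mod-refl : ∀ {a} → a ≡ a mod p
    ≡mod-refl {a} = divides-difference (divides (+ 0) (lemma a (+ p)))
      where lemma : ∀ a q → a - a ≡ + 0 * q
            lemma = solve-∀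

    ≡mod-sym : ∀ {a b} → a ≡ b mod p → b ≡ a mod p
    ≡mod-sym {a} {b} (divides-difference d) = divides-difference (∣-resp-≡ (lemma a b) (∣m⇒∣-m d))
      where lemma : ∀ a b → - (a - b) ≡ b - a
            lemma = solve-∀

    ≡mod-trans : ∀ {a b c} → a ≡ b mod p → b ≡ c mod p → a ≡ c mod p
    ≡mod-trans {a} {b} {c} (divides-difference d) (divides-difference e) =
      divides-difference (∣-resp-≡ (lemma a b c) (∣m∣n⇒∣m+n d e))
      where lemma : ∀ a b c → (a - b) + (b - c) ≡ a - c
            lemma = solve-∀

    *-cong-mod : ∀ {a b c d} → a ≡ b mod p → c ≡ d mod p → a * c ≡ b * d mod p
    *-cong-mod {a} {b} {c} {d} (divides-difference a-b) (divides-difference c-d) =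
      divides-difference (∣-resp-≡ (lemma a b c d) (∣m∣n⇒∣m+n (∣n⇒∣m*n a c-d) (∣m⇒∣m*n d a-b)))
      where lemma : ∀ a b c d → a * (c - d) + (a - b) * d ≡ a * c - b * d
            lemma = solve-∀

    ≡mod⇒≡ : ∀ {m n} → m < p → n < p → + m ≡ + n mod p → m ≡ n
    ≡mod⇒≡ {m} {n} m<p n<p (divides-difference d) =
      ℤ.+-injective (ℤ.i-j≡0⇒i≡j _ _ (ℤ.∣i∣≡0⇒i≡0 (∣∧<⇒≡0 (∣⇒∣ᵤ d) ∣m-n∣<p)))
      where
      ∣m-n∣<p : abs (+ m - + n) < p
      ∣m-n∣<p rewrite ℤ.m-n≡m⊖n m n = ℕ.≤-<-trans (ℤ.∣m⊝n∣≤m⊔n m n) (ℕ.⊔-lub m<p n<p)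
      ∣∧<⇒≡0 : ∀ {x} → p ℕ.∣ x → x < p → x ≡ 0
      ∣∧<⇒≡0 {zero}  _   _   = refl
      ∣∧<⇒≡0 {suc x} p∣x x<p = ⊥-elim (ℕ.<⇒≱ x<p (ℕ.∣⇒≤ p∣x))

    %≡⇒≡mod : .{{_ : NonZero p}} → ∀ {m n} → m % p ≡ n % p → + m ≡ + n mod p
    %≡⇒≡mod {m} {n} m%p≡n%p = divides-difference (divides (+ (m / p) - + (n / p)) (begin
      + m - + n
        ≡⟨ cong₂ (λ x y → + x - + y) (m≡m%n+[m/n]*n m p) (m≡m%n+[m/n]*n n p) ⟩
      + (m % p ℕ.+ m / p ℕ.* p) - + (n % p ℕ.+ n / p ℕ.* p)
        ≡⟨ cong (λ r → + (m % p ℕ.+ m / p ℕ.* p) - + (r ℕ.+ n / p ℕ.* p)) (sym m%p≡n%p) ⟩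
      + (m % p ℕ.+ m / p ℕ.* p) - + (m % p ℕ.+ n / p ℕ.* p)
        ≡⟨ cong₂ _-_ (pos-+* (m % p) (m / p) p) (pos-+* (m % p) (n / p) p) ⟩
      (+ (m % p) + + (m / p) * + p) - (+ (m % p) + + (n / p) * + p)
        ≡⟨ lemma (+ (m % p)) (+ (m / p)) (+ (n / p)) (+ p) ⟩
      (+ (m / p) - + (n / p)) * + p ∎))
      where
      open ≡-Reasoning
      pos-+* : ∀ r q p → + (r ℕ.+ q ℕ.* p) ≡ + r + + q * + p
      pos-+* r q p = trans (ℤ.pos-+ r (q ℕ.* p)) (cong (_+_ (+ r)) (ℤ.pos-* q p))
      lemma : ∀ r q q′ p → (r + q * p) - (r + q′ * p) ≡ (q - q′) * p
      lemma = solve-∀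

    ≡⇒≡mod : ∀ {a b} → a ≡ b → a ≡ b mod p
    ≡⇒≡mod refl = ≡mod-refl

    *-congˡ-mod : ∀ c {a b} → a ≡ b mod p → c * a ≡ c * b mod p
    *-congˡ-mod c = *-cong-mod (≡mod-refl {c})

  ≡mod-setoid : ℕ → Setoid 0ℓ 0ℓ
  ≡mod-setoid p = record
    { Carrier       = ℤ
    ; _≈_           = λ a b → a ≡ b mod p
    ; isEquivalence = record { refl = ≡mod-refl ; sym = ≡mod-sym ; trans = ≡mod-trans }
    }

  module ≡mod-Reasoning (p : ℕ) = SetoidReasoning (≡mod-setoid p)

  infix 4 _≡±_mod_
  _≡±_mod_ : ℕ → ℕ → ℕ → Set
  m ≡± n mod p = ∃ λ s → + m ≡ s ◃ n mod p

  module _ {p : ℕ} where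

    private
      ◃-scale : ∀ s t n → (s ◃ 1) * (t ◃ n) ≡ (s Sign.* t) ◃ n
      ◃-scale s t n = trans (sym (ℤ.◃-distrib-* s t 1 n)) (cong ((s Sign.* t) ◃_) (ℕ.*-identityˡ n))

      ◃-as-scale : ∀ s n → s ◃ n ≡ (s ◃ 1) * + n
      ◃-as-scale s n = trans (cong (_◃ n) (sym (Sign.*-identityʳ s)))
                         (trans (sym (◃-scale s Sign.+ n)) (cong ((s ◃ 1) *_) (ℤ.+◃n≡+n n)))

    ≡mod⇒≡± : ∀ {m n} → + m ≡ + n mod p → m ≡± n mod p
    ≡mod⇒≡± {n = n} m≡n = Sign.+ , ≡mod-trans m≡n (≡⇒≡mod (sym (ℤ.+◃n≡+n n)))

    ≡±-refl : ∀ {m} → m ≡± m mod p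
    ≡±-refl = ≡mod⇒≡± ≡mod-refl

    ≡±-sym : ∀ {m n} → m ≡± n mod p → n ≡± m mod p
    ≡±-sym {m} {n} (s , m≡sn) = s , (begin
      + n                ≡⟨ trans (cong (_◃ n) (Sign.s*s≡+ s)) (ℤ.+◃n≡+n n) ⟨
      (s Sign.* s) ◃ n   ≡⟨ ◃-scale s s n ⟨
      (s ◃ 1) * (s ◃ n)  ≈⟨ *-congˡ-mod (s ◃ 1) m≡sn ⟨
      (s ◃ 1) * + m      ≡⟨ ◃-as-scale s m ⟨
      s ◃ m              ∎)
      where open ≡mod-Reasoning p

    ≡±-trans : ∀ {m n o} → m ≡± n mod p → n ≡± o mod p → m ≡± o mod p
    ≡±-trans {m} {n} {o} (s , m≡sn) (t , n≡to) = s Sign.* t , (begin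
      + m                ≈⟨ m≡sn ⟩
      s ◃ n              ≡⟨ ◃-as-scale s n ⟩
      (s ◃ 1) * + n      ≈⟨ *-congˡ-mod (s ◃ 1) n≡to ⟩
      (s ◃ 1) * (t ◃ o)  ≡⟨ ◃-scale s t o ⟩
      (s Sign.* t) ◃ o   ∎)
      where open ≡mod-Reasoning p

    ≡±-* : ∀ {m n m′ n′} → m ≡± n mod p → m′ ≡± n′ mod p → m ℕ.* m′ ≡± n ℕ.* n′ mod p
    ≡±-* {m} {n} {m′} {n′} (s , m≡sn) (t , m′≡tn′) = s Sign.* t , (begin
      + (m ℕ.* m′)                ≡⟨ ℤ.pos-* m m′ ⟩
      + m * + m′                  ≈⟨ *-cong-mod m≡sn m′≡tn′ ⟩
      (s ◃ n) * (t ◃ n′)          ≡⟨ ℤ.◃-distrib-* s t n n′ ⟨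
      (s Sign.* t) ◃ (n ℕ.* n′)   ∎)
      where open ≡mod-Reasoning p

    ≡±-^ : ∀ {m n} e → m ≡± n mod p → m ℕ.^ e ≡± n ℕ.^ e mod p
    ≡±-^ zero    _    = ≡±-refl
    ≡±-^ (suc e) m≡±n = ≡±-* m≡±n (≡±-^ e m≡±n)

    ≡±-complement : ∀ {x} → x ≤ p → x ≡± p ℕ.∸ x mod p
    ≡±-complement {x} x≤p = Sign.- , divides-difference (divides (+ 1) (begin
      + x - (Sign.- ◃ (p ℕ.∸ x))  ≡⟨ cong (_-_ (+ x)) (ℤ.-◃n≡-n (p ℕ.∸ x)) ⟩
      + x + - - + (p ℕ.∸ x)       ≡⟨ cong (_+_ (+ x)) (ℤ.neg-involutive (+ (p ℕ.∸ x))) ⟩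
      + x + + (p ℕ.∸ x)           ≡⟨ sym (ℤ.pos-+ x (p ℕ.∸ x)) ⟩
      + (x ℕ.+ (p ℕ.∸ x))         ≡⟨ cong +_ (ℕ.m+[n∸m]≡n x≤p) ⟩
      + p                         ≡⟨ sym (ℤ.*-identityˡ (+ p)) ⟩
      + 1 * + p                   ∎))
      where open ≡-Reasoning

    ≡±⇒≡ : ∀ {m n} → 2 ℕ.* m < p → 2 ℕ.* n < p → m ≡± n mod p → m ≡ n
    ≡±⇒≡ {m} {n} 2m<p 2n<p (Sign.+ , m≡n) =
      ≡mod⇒≡ (half<p 2m<p) (half<p 2n<p) (≡mod-trans m≡n (≡⇒≡mod (ℤ.+◃n≡+n n)))
      where
      half<p : ∀ {x} → 2 ℕ.* x < p → x < p
      half<p {x} 2x<p = ℕ.≤-<-trans (ℕ.m≤m+n x (x ℕ.+ 0)) 2x<p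
    ≡±⇒≡ {m} {n} 2m<p 2n<p (Sign.- , m≡-n) = trans (ℕ.m+n≡0⇒m≡0 m m+n≡0) (sym (ℕ.m+n≡0⇒n≡0 m m+n≡0))
      where
      m+n<p : m ℕ.+ n < p
      m+n<p = ℕ.*-cancelˡ-< 2 (m ℕ.+ n) p (begin-strict
        2 ℕ.* (m ℕ.+ n)     ≡⟨ ℕ.*-distribˡ-+ 2 m n ⟩
        2 ℕ.* m ℕ.+ 2 ℕ.* n <⟨ ℕ.+-mono-< 2m<p 2n<p ⟩
        p ℕ.+ p             ≡⟨ cong (p ℕ.+_) (sym (ℕ.+-identityʳ p)) ⟩
        2 ℕ.* p             ∎)
        where open ℕ.≤-Reasoning
      m+n≡0 : m ℕ.+ n ≡ 0
      m+n≡0 = ≡mod⇒≡ m+n<p (ℕ.m<n⇒0<n m+n<p) (divides-difference (∣-resp-≡ eq (p∣a-b m≡-n)))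
        where
        lemma : ∀ a b → a - (- b) ≡ (a + b) - + 0
        lemma = solve-∀
        eq : + m - (Sign.- ◃ n) ≡ + (m ℕ.+ n) - + 0
        eq = trans (cong (_-_ (+ m)) (ℤ.-◃n≡-n n)) (trans (lemma (+ m) (+ n)) (cong (_- + 0) (sym (ℤ.pos-+ m n))))

  module _ {p : ℕ} .{{_ : NonZero p}} where

    *-cong-% : ∀ {m m′ n n′} → m % p ≡ m′ % p → n % p ≡ n′ % p → (m ℕ.* n) % p ≡ (m′ ℕ.* n′) % p
    *-cong-% {m} {m′} {n} {n′} m≡m′ n≡n′ = begin
      (m ℕ.* n) % p             ≡⟨ %-distribˡ-* m n p ⟩
      (m % p ℕ.* (n % p)) % p   ≡⟨ cong₂ (λ x y → (x ℕ.* y) % p) m≡m′ n≡n′ ⟩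
      (m′ % p ℕ.* (n′ % p)) % p ≡⟨ sym (%-distribˡ-* m′ n′ p) ⟩
      (m′ ℕ.* n′) % p           ∎
      where open ≡-Reasoning

    ^-cong-% : ∀ {m n} e → m % p ≡ n % p → (m ℕ.^ e) % p ≡ (n ℕ.^ e) % p
    ^-cong-% zero    _   = refl
    ^-cong-% (suc e) m≡n = *-cong-% m≡n (^-cong-% e m≡n)

module PolynomialRoots where

  open import Data.Nat.Base as ℕ using (ℕ; zero; suc; _≤_; _<_; z≤n; s≤s; NonZero; _^_)
  open import Data.Nat.DivMod using (_%_)
  import Data.Nat.Divisibility as ℕ
  open import Data.Nat.Primality using (Prime; ¬prime[1])
  open import Data.Integer.Base using (ℤ; +_; _+_; _*_; _-_; -_)
  import Data.Integer.Properties as ℤ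
  open import Data.Integer.Divisibility.Signed using (_∣_; ∣⇒∣ᵤ; ∣m∣n⇒∣m-n)
  open import Data.Integer.Tactic.RingSolver using (solve-∀)
  open import Data.List.Base using (List; []; _∷_; length; replicate)
  open import Data.List.Properties using (length-replicate)
  open import Data.List.Relation.Unary.All as All using (All; []; _∷_)
  open import Data.List.Relation.Unary.Unique.Propositional using (Unique; []; _∷_)
  open import Data.Sum.Base using (inj₁; inj₂)
  open import Data.Empty using (⊥-elim)
  open import Relation.Binary.PropositionalEquality
  open Modular

  monic : List ℤ → ℤ → ℤ
  monic []       x = + 1
  monic (c ∷ cs) x = c + x * monic cs x

  deflate : List ℤ → ℤ → List ℤ
  deflate []       r = []
  deflate (c ∷ cs) r = monic (c ∷ cs) r ∷ deflate cs r

  length-deflate : ∀ cs r → length (deflate cs r) ≡ length cs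
  length-deflate []       r = refl
  length-deflate (c ∷ cs) r = cong suc (length-deflate cs r)

  monic-factor : ∀ c cs x r → monic (c ∷ cs) x - monic (c ∷ cs) r ≡ (x - r) * monic (deflate cs r) x
  monic-factor c []        x r = lemma c x r
    where lemma : ∀ c x r → (c + x * + 1) - (c + r * + 1) ≡ (x - r) * + 1
          lemma = solve-∀
  monic-factor c (c′ ∷ cs) x r = begin
    (c + x * f x) - (c + r * f r)                 ≡⟨ cong (λ y → (c + x * y) - (c + r * f r)) f[x]≡ ⟩
    (c + x * (f r + (x - r) * q x)) - (c + r * f r) ≡⟨ lemma c x r (f r) (q x) ⟩
    (x - r) * (f r + x * q x)                       ∎
    where
    open ≡-Reasoning
    f q : ℤ → ℤ
    f = monic (c′ ∷ cs)
    q = monic (deflate cs r)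
    f[x]≡ : f x ≡ f r + (x - r) * q x
    f[x]≡ = trans (split (f x) (f r)) (cong (_+_ (f r)) (monic-factor c′ cs x r))
      where split : ∀ a b → a ≡ b + (a - b)
            split = solve-∀
    lemma : ∀ c x r b w → (c + x * (b + (x - r) * w)) - (c + r * b) ≡ (x - r) * (b + x * w)
    lemma = solve-∀

  module _ {p : ℕ} (p-prime : Prime p) where

    roots≤degree : ∀ cs rs → Unique rs → All (_< p) rs → All (λ r → + p ∣ monic cs (+ r)) rs →
                   length rs ≤ length cs
    roots≤degree cs       []       _ _ _ = z≤n
    roots≤degree []       (r ∷ rs) _ _ (p∣1 ∷ _) =
      ⊥-elim (¬prime[1] (subst Prime (ℕ.∣1⇒≡1 (∣⇒∣ᵤ p∣1)) p-prime))
    roots≤degree (c ∷ cs) (r ∷ rs) (r∉rs ∷ unique) (r<p ∷ rs<p) (p∣f[r] ∷ p∣f[rs]) =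
      s≤s (subst (length rs ≤_) (length-deflate cs (+ r))
            (roots≤degree (deflate cs (+ r)) rs unique rs<p
              (All.tabulate λ r′∈rs → root-of-quotient (All.lookup r∉rs r′∈rs)
                                        (All.lookup rs<p r′∈rs) (All.lookup p∣f[rs] r′∈rs))))
      where
      root-of-quotient : ∀ {r′} → r ≢ r′ → r′ < p → + p ∣ monic (c ∷ cs) (+ r′) →
                         + p ∣ monic (deflate cs (+ r)) (+ r′)
      root-of-quotient {r′} r≢r′ r′<p p∣f[r′]
        with prime∣*⇒∣⊎∣ p-prime (+ r′ - + r) _
               (subst (+ p ∣_) (monic-factor c cs (+ r′) (+ r)) (∣m∣n⇒∣m-n p∣f[r′] p∣f[r]))
      ... | inj₁ p∣r′-r = ⊥-elim (r≢r′ (sym (≡mod⇒≡ r′<p r<p (divides-difference p∣r′-r))))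
      ... | inj₂ p∣q[r′] = p∣q[r′]

    unityRoots≤ : .{{_ : NonZero p}} → ∀ {t} → 0 < t → ∀ rs → Unique rs → All (_< p) rs →
                  All (λ g → (g ^ t) % p ≡ 1 % p) rs → length rs ≤ t
    unityRoots≤ {t = suc t} _ rs unique rs<p rs-roots =
      subst (length rs ≤_) (cong suc (length-replicate t))
        (roots≤degree (- + 1 ∷ replicate t (+ 0)) rs unique rs<p (All.map (λ {g} → root {g}) rs-roots))
      where
      monic-xⁿ : ∀ n g → monic (replicate n (+ 0)) (+ g) ≡ + (g ^ n)
      monic-xⁿ zero    g = refl
      monic-xⁿ (suc n) g = trans (ℤ.+-identityˡ _)
        (trans (cong (+ g *_) (monic-xⁿ n g)) (sym (ℤ.pos-* g (g ^ n))))
      root : ∀ {g} → (g ^ suc t) % p ≡ 1 % p → + p ∣ monic (- + 1 ∷ replicate t (+ 0)) (+ g)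
      root {g} gᵗ≡1 = subst (+ p ∣_) eq (p∣a-b (%≡⇒≡mod gᵗ≡1))
        where
        eq : + (g ^ suc t) - + 1 ≡ - + 1 + + g * monic (replicate t (+ 0)) (+ g)
        eq = trans (ℤ.+-comm (+ (g ^ suc t)) (- + 1))
               (cong (_+_ (- + 1)) (trans (ℤ.pos-* g (g ^ t)) (cong (+ g *_) (sym (monic-xⁿ t g)))))

module Lists where

  open import Data.Nat.Base using (suc; _≤_; z≤n; s≤s)
  open import Data.List.Base using (List; []; _∷_; length; map)
  open import Data.List.Relation.Unary.All as All using (All; []; _∷_)
  open import Data.List.Relation.Unary.All.Properties using (map⁺)
  open import Data.List.Relation.Unary.Any using (here; there)
  open import Data.List.Relation.Unary.Unique.Propositional using (Unique; []; _∷_)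
  open import Data.List.Membership.Propositional using (_∈_)
  open import Data.List.Membership.Propositional.Properties using (∈-map⁻)
  open import Data.List.Relation.Binary.Subset.Propositional using (_⊆_)
  open import Data.Product.Base using (∃; _×_; _,_)
  open import Data.Empty using (⊥-elim)
  open import Relation.Binary.PropositionalEquality

  module _ {A : Set} where

    private
      remove : ∀ {x : A} ys → x ∈ ys → List A
      remove (_ ∷ ys) (here _)    = ys
      remove (y ∷ ys) (there x∈ys) = y ∷ remove ys x∈ys

      length-remove : ∀ {x : A} ys (x∈ys : x ∈ ys) → suc (length (remove ys x∈ys)) ≡ length ys
      length-remove (_ ∷ ys) (here _)     = refl
      length-remove (_ ∷ ys) (there x∈ys) = cong suc (length-remove ys x∈ys)

      ∈-remove : ∀ {x z : A} ys (x∈ys : x ∈ ys) → z ∈ ys → x ≢ z → z ∈ remove ys x∈ys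
      ∈-remove (_ ∷ _)  (here refl)  (here refl)  x≢z = ⊥-elim (x≢z refl)
      ∈-remove (_ ∷ _)  (here refl)  (there z∈ys) _   = z∈ys
      ∈-remove (_ ∷ _)  (there _)    (here refl)  _   = here refl
      ∈-remove (_ ∷ ys) (there x∈ys) (there z∈ys) x≢z = there (∈-remove ys x∈ys z∈ys x≢z)

    Unique∧⊆⇒length≤ : ∀ {xs ys : List A} → Unique xs → xs ⊆ ys → length xs ≤ length ys
    Unique∧⊆⇒length≤ {[]}     _                  _     = z≤n
    Unique∧⊆⇒length≤ {x ∷ xs} {ys} (x∉xs ∷ unique) xs⊆ys =
      subst (suc (length xs) ≤_) (length-remove ys x∈ys)
        (s≤s (Unique∧⊆⇒length≤ unique λ z∈xs →
          ∈-remove ys x∈ys (xs⊆ys (there z∈xs)) (All.lookup x∉xs z∈xs)))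
      where x∈ys = xs⊆ys (here refl)

  module _ {A B : Set} (f : A → B) where

    Unique-map⁺ : ∀ {xs} → (∀ {x y} → x ∈ xs → y ∈ xs → f x ≡ f y → x ≡ y) →
                  Unique xs → Unique (map f xs)
    Unique-map⁺ {[]}     _   []                = []
    Unique-map⁺ {x ∷ xs} inj (x∉xs ∷ unique) =
      map⁺ (All.tabulate λ y∈xs fx≡fy → All.lookup x∉xs y∈xs (inj (here refl) (there y∈xs) fx≡fy))
      ∷ Unique-map⁺ (λ x∈ y∈ → inj (there x∈) (there y∈)) unique

    map-preimage : ∀ {xs} ys → All (_∈ map f xs) ys → ∃ λ zs → map f zs ≡ ys × All (_∈ xs) zs
    map-preimage []       []                     = [] , refl , []
    map-preimage (y ∷ ys) (y∈ ∷ ys∈) with ∈-map⁻ f y∈ | map-preimage ys ys∈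
    ... | z , z∈xs , refl | zs , refl , zs∈xs = z ∷ zs , refl , z∈xs ∷ zs∈xs

module ExponentVectors where

  open import Data.Nat.Base using (ℕ; zero; suc; _+_; _∸_; _≤_; z≤n; s≤s)
  import Data.Nat.Properties as ℕ
  open import Data.Nat.Combinatorics using (_C_; nCn≡1; nCk+nC[k+1]≡[n+1]C[k+1])
  open import Data.Nat.ListAction using (sum)
  open import Data.List.Base using (List; []; _∷_; length; map; _++_)
  open import Data.List.Properties using (length-map; length-++; ∷-injectiveʳ)
  open import Data.List.Relation.Unary.All as All using (All; []; _∷_)
  open import Data.List.Relation.Unary.All.Properties using (map⁺; ++⁺)
  open import Data.List.Relation.Unary.Unique.Propositional using (Unique; []; _∷_)
  import Data.List.Relation.Unary.Unique.Propositional.Properties as Unique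
  open import Data.List.Membership.Propositional using (_∈_)
  open import Data.List.Membership.Propositional.Properties using (∈-map⁻)
  open import Data.Product.Base using (_×_; _,_; proj₁)
  open import Relation.Nullary.Negation using (¬_)
  open import Relation.Binary.PropositionalEquality

  incrementHead : List ℕ → List ℕ
  incrementHead []       = []
  incrementHead (e ∷ es) = suc e ∷ es

  exponents : ℕ → ℕ → List (List ℕ)
  exponents zero    D       = [] ∷ []
  exponents (suc n) zero    = map (0 ∷_) (exponents n zero)
  exponents (suc n) (suc D) = map (0 ∷_) (exponents n (suc D)) ++ map incrementHead (exponents (suc n) D)

  length-exponents : ∀ n D → length (exponents n D) ≡ (D + n) C n
  length-exponents zero    D       = refl
  length-exponents (suc n) zero    = begin
    length (map (0 ∷_) (exponents n 0)) ≡⟨ length-map (0 ∷_) (exponents n 0) ⟩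
    length (exponents n 0)              ≡⟨ length-exponents n 0 ⟩
    n C n                               ≡⟨ trans (nCn≡1 n) (sym (nCn≡1 (suc n))) ⟩
    suc n C suc n                       ∎
    where open ≡-Reasoning
  length-exponents (suc n) (suc D) = begin
    length (map (0 ∷_) (exponents n (suc D)) ++ map incrementHead (exponents (suc n) D))
      ≡⟨ length-++ (map (0 ∷_) (exponents n (suc D))) ⟩
    length (map (0 ∷_) (exponents n (suc D))) + length (map incrementHead (exponents (suc n) D))
      ≡⟨ cong₂ _+_ (length-map (0 ∷_) (exponents n (suc D))) (length-map incrementHead (exponents (suc n) D)) ⟩
    length (exponents n (suc D)) + length (exponents (suc n) D)
      ≡⟨ cong₂ _+_ (length-exponents n (suc D)) (length-exponents (suc n) D) ⟩
    (suc D + n) C n + (D + suc n) C suc n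
      ≡⟨ cong (λ m → m C n + (D + suc n) C suc n) (sym (ℕ.+-suc D n)) ⟩
    (D + suc n) C n + (D + suc n) C suc n
      ≡⟨ nCk+nC[k+1]≡[n+1]C[k+1] (D + suc n) n ⟩
    (suc D + suc n) C suc n ∎
    where open ≡-Reasoning

  ExponentVector : ℕ → ℕ → List ℕ → Set
  ExponentVector n D e = length e ≡ n × sum e ≤ D

  private
    prepend0 : ∀ {n D e} → ExponentVector n D e → ExponentVector (suc n) D (0 ∷ e)
    prepend0 (len , s) = cong suc len , s

    increment : ∀ {n D e} → ExponentVector (suc n) D e → ExponentVector (suc n) (suc D) (incrementHead e)
    increment {e = _ ∷ _} (len , s) = len , s≤s s

  exponents-sound : ∀ n D → All (ExponentVector n D) (exponents n D)
  exponents-sound zero    D       = (refl , z≤n) ∷ []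
  exponents-sound (suc n) zero    = map⁺ (All.map (λ {e} → prepend0 {e = e}) (exponents-sound n zero))
  exponents-sound (suc n) (suc D) =
    ++⁺ (map⁺ (All.map (λ {e} → prepend0 {e = e}) (exponents-sound n (suc D))))
        (map⁺ (All.map (λ {e} → increment {e = e}) (exponents-sound (suc n) D)))

  ∈-exponents : ∀ {n D e} → e ∈ exponents n D → ExponentVector n D e
  ∈-exponents {n} {D} = All.lookup (exponents-sound n D)

  exponents-unique : ∀ n D → Unique (exponents n D)
  exponents-unique zero    D       = [] ∷ []
  exponents-unique (suc n) zero    = Unique.map⁺ ∷-injectiveʳ (exponents-unique n zero)
  exponents-unique (suc n) (suc D) =
    Unique.++⁺ (Unique.map⁺ ∷-injectiveʳ (exponents-unique n (suc D)))
               (Unique.map⁺ incrementHead-injective (exponents-unique (suc n) D))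
               disjoint
    where
    incrementHead-injective : ∀ {e f} → incrementHead e ≡ incrementHead f → e ≡ f
    incrementHead-injective {[]}    {[]}    _    = refl
    incrementHead-injective {_ ∷ _} {_ ∷ _} refl = refl
    disjoint : ∀ {v} → ¬ (v ∈ map (0 ∷_) (exponents n (suc D)) × v ∈ map incrementHead (exponents (suc n) D))
    disjoint (v∈ , v∈′) with ∈-map⁻ (0 ∷_) v∈ | ∈-map⁻ incrementHead v∈′
    ... | _ , _ , refl | _ ∷ _ , _ , ()
    ... | _ , _ , refl | [] , e∈ , _ with () ← proj₁ (∈-exponents {suc n} {D} e∈)

  homogenise : ℕ → List ℕ → List ℕ
  homogenise D e = D ∸ sum e ∷ e

  sum-homogenise : ∀ {D} e → sum e ≤ D → sum (homogenise D e) ≡ D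
  sum-homogenise e = ℕ.m∸n+n≡m

module Valuation where

  open import Data.Nat.Base as ℕ using (ℕ; zero; suc; _+_; _*_; _^_; _≤_; _<_; z≤n; s≤s; NonZero)
  import Data.Nat.Properties as ℕ
  open import Data.Nat.Divisibility
    using (_∣_; _∤_; divides; _∣?_; m∣m*n; ∣⇒≤)
  open import Data.Nat.Primality using (Prime; euclidsLemma; prime⇒irreducible; prime⇒nonTrivial)
  open import Data.Nat.Primality.Factorisation using (factorise)
  open import Data.List.Base using ([]; _∷_)
  open import Data.List.Relation.Unary.All using (_∷_)
  open import Data.Sum.Base using (inj₁; inj₂)
  open import Data.Product.Base using (∃; ∃₂; _×_; _,_)
  open import Data.Empty using (⊥-elim)
  open import Data.Nat.Induction using (<-wellFounded)
  open import Induction.WellFounded using (Acc; acc)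
  open import Relation.Nullary using (yes; no)
  open import Relation.Binary.PropositionalEquality
  open import Data.Nat.Tactic.RingSolver using (solve-∀)

  prime⇒≥2 : ∀ {q} → Prime q → 2 ≤ q
  prime⇒≥2 {q} q-prime = ℕ.nonTrivial⇒n>1 q {{prime⇒nonTrivial q-prime}}

  private
    valFuel : ℕ → ℕ → ℕ → ℕ
    valFuel zero    q n = 0
    valFuel (suc f) q n with q ∣? n
    ... | yes (divides k _) = suc (valFuel f q k)
    ... | no  _             = 0

    ∤⇒≥1 : ∀ {q m} → q ∤ m → 1 ≤ m
    ∤⇒≥1 {m = zero}  q∤0 = ⊥-elim (q∤0 (divides 0 refl))
    ∤⇒≥1 {m = suc m} _   = s≤s z≤n

    n<2^n : ∀ n → n < 2 ^ n
    n<2^n zero    = s≤s z≤n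
    n<2^n (suc n) = ℕ.+-mono-≤-< (ℕ.m^n>0 2 n) (ℕ.≤-trans (n<2^n n) (ℕ.m≤m+n (2 ^ n) 0))

    ≡*q⇒≥1 : ∀ {q x y} → x ≡ y * q → 1 ≤ x → 1 ≤ y
    ≡*q⇒≥1 {y = zero}  refl ()
    ≡*q⇒≥1 {y = suc y} _    _  = s≤s z≤n

  -- Meaningful for q ≥ 2 and n ≥ 1; the fuel n suffices because q ^ a ∣ n ≥ 1 forces a < n.
  val : ℕ → ℕ → ℕ
  val q n = valFuel n q n

  module _ {q : ℕ} (q≥2 : 2 ≤ q) where

    private
      instance
        q≢0 : NonZero q
        q≢0 = ℕ.>-nonZero (ℕ.≤-trans (s≤s z≤n) q≥2)

      q^[1+a]*m≡ : ∀ a m → q ^ suc a * m ≡ (q ^ a * m) * q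
      q^[1+a]*m≡ a m = trans (ℕ.*-assoc q (q ^ a) m) (ℕ.*-comm q (q ^ a * m))

      valFuel-char : ∀ a m f n → q ∤ m → a ≤ f → n ≡ q ^ a * m → valFuel f q n ≡ a
      valFuel-char zero    m zero    n _   _         _          = refl
      valFuel-char zero    m (suc f) n q∤m _         n≡1*m with q ∣? n
      ... | yes q∣n = ⊥-elim (q∤m (subst (q ∣_) (trans n≡1*m (ℕ.*-identityˡ m)) q∣n))
      ... | no  _   = refl
      valFuel-char (suc a) m (suc f) n q∤m (s≤s a≤f) n≡q^a*m with q ∣? n
      ... | no  q∤n              = ⊥-elim (q∤n (divides (q ^ a * m) (trans n≡q^a*m (q^[1+a]*m≡ a m))))
      ... | yes (divides k n≡kq) = cong suc (valFuel-char a m f k q∤m a≤f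
                                     (ℕ.*-cancelʳ-≡ k _ q (trans (sym n≡kq) (trans n≡q^a*m (q^[1+a]*m≡ a m)))))

      decompositionFuel : ∀ f n → n ≤ f → 1 ≤ n → ∃₂ λ a m → n ≡ q ^ a * m × q ∤ m
      decompositionFuel f n n≤f n≥1 with q ∣? n
      ... | no  q∤n = 0 , n , sym (ℕ.*-identityˡ n) , q∤n
      decompositionFuel (suc f) n n≤f n≥1 | yes (divides k n≡kq) =
        let a , m , k≡q^a*m , q∤m = decompositionFuel f k k≤f k≥1
        in suc a , m , trans n≡kq (trans (cong (_* q) k≡q^a*m) (sym (q^[1+a]*m≡ a m))) , q∤m
        where
        k≥1 = ≡*q⇒≥1 n≡kq n≥1
        k≤f : k ≤ f
        k≤f = ℕ.≤-pred (ℕ.≤-trans (ℕ.m<m*n k q q≥2) (subst (_≤ suc f) n≡kq n≤f))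
          where instance _ = ℕ.>-nonZero k≥1
      decompositionFuel zero n n≤0 n≥1 | yes _ = ⊥-elim (ℕ.<⇒≱ n≥1 n≤0)

    val-char : ∀ a m n → n ≡ q ^ a * m → q ∤ m → val q n ≡ a
    val-char a m n n≡q^a*m q∤m = valFuel-char a m n n q∤m a≤n n≡q^a*m
      where
      a≤n : a ≤ n
      a≤n = begin
        a           ≤⟨ ℕ.<⇒≤ (n<2^n a) ⟩
        2 ^ a       ≤⟨ ℕ.^-monoˡ-≤ a q≥2 ⟩
        q ^ a       ≤⟨ ℕ.m≤m*n (q ^ a) m ⟩
        q ^ a * m   ≡⟨ sym n≡q^a*m ⟩
        n           ∎
        where
        open ℕ.≤-Reasoning
        instance _ = ℕ.>-nonZero (∤⇒≥1 q∤m)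

    val-decomposition : ∀ n → 1 ≤ n → ∃ λ m → n ≡ q ^ val q n * m × q ∤ m
    val-decomposition n n≥1 with a , m , n≡q^a*m , q∤m ← decompositionFuel n n ℕ.≤-refl n≥1
      rewrite val-char a m n n≡q^a*m q∤m = m , n≡q^a*m , q∤m

    val-∤ : ∀ {n} → q ∤ n → val q n ≡ 0
    val-∤ {n} q∤n = val-char 0 n n (sym (ℕ.*-identityˡ n)) q∤n

    val-< : ∀ {n} → 1 ≤ n → n < q → val q n ≡ 0
    val-< {n} n≥1 n<q = val-∤ (λ q∣n → ℕ.<⇒≱ n<q (∣⇒≤ q∣n))
      where instance _ = ℕ.>-nonZero n≥1

    val-1 : val q 1 ≡ 0
    val-1 = val-< (s≤s z≤n) q≥2

    val-self : val q q ≡ 1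
    val-self = val-char 1 1 q (sym (trans (ℕ.*-identityʳ (q * 1)) (ℕ.*-identityʳ q)))
                           (λ q∣1 → ℕ.<⇒≱ q≥2 (∣⇒≤ q∣1))

    val≥1⇒∣ : ∀ {n} → 1 ≤ val q n → q ∣ n
    val≥1⇒∣ {n} v≥1 with q ∣? n
    ... | yes q∣n = q∣n
    ... | no  q∤n = ⊥-elim (ℕ.<⇒≱ v≥1 (ℕ.≤-reflexive (val-∤ q∤n)))

    ∣⇒val≥1 : ∀ {n} → 1 ≤ n → q ∣ n → 1 ≤ val q n
    ∣⇒val≥1 {n} n≥1 q∣n with val-decomposition n n≥1
    ... | m , n≡ , q∤m with val q n
    ...   | suc _ = s≤s z≤n
    ...   | zero  = ⊥-elim (q∤m (subst (q ∣_) (trans n≡ (ℕ.*-identityˡ m)) q∣n))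

  module _ {q : ℕ} (q-prime : Prime q) where

    private
      q≥2 : 2 ≤ q
      q≥2 = prime⇒≥2 q-prime

    val-* : ∀ {m n} → 1 ≤ m → 1 ≤ n → val q (m * n) ≡ val q m + val q n
    val-* {m} {n} m≥1 n≥1
      with m′ , m≡ , q∤m′ ← val-decomposition q≥2 m m≥1
         | n′ , n≡ , q∤n′ ← val-decomposition q≥2 n n≥1 =
      val-char q≥2 (a + b) (m′ * n′) (m * n) mn≡ q∤m′n′
      where
      a = val q m
      b = val q n
      mn≡ : m * n ≡ q ^ (a + b) * (m′ * n′)
      mn≡ = begin
        m * n                         ≡⟨ cong₂ _*_ m≡ n≡ ⟩
        (q ^ a * m′) * (q ^ b * n′)   ≡⟨ interchange (q ^ a) m′ (q ^ b) n′ ⟩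
        (q ^ a * q ^ b) * (m′ * n′)   ≡⟨ cong (_* (m′ * n′)) (sym (ℕ.^-distribˡ-+-* q a b)) ⟩
        q ^ (a + b) * (m′ * n′)       ∎
        where
        open ≡-Reasoning
        interchange : ∀ w x y z → (w * x) * (y * z) ≡ (w * y) * (x * z)
        interchange = solve-∀
      q∤m′n′ : q ∤ m′ * n′
      q∤m′n′ q∣m′n′ with euclidsLemma m′ n′ q-prime q∣m′n′
      ... | inj₁ q∣m′ = q∤m′ q∣m′
      ... | inj₂ q∣n′ = q∤n′ q∣n′

    val-^ : ∀ {m} e → 1 ≤ m → val q (m ^ e) ≡ e * val q m
    val-^ zero    _   = val-1 q≥2
    val-^ {m} (suc e) m≥1 =
      trans (val-* m≥1 (ℕ.m^n>0 m e)) (cong (val q m +_) (val-^ e m≥1))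
      where instance _ = ℕ.>-nonZero m≥1

    val-prime : ∀ {r} → Prime r → q ≢ r → val q r ≡ 0
    val-prime {r} r-prime q≢r = val-∤ q≥2 q∤r
      where
      q∤r : q ∤ r
      q∤r q∣r with prime⇒irreducible r-prime q∣r
      ... | inj₁ refl = ℕ.<⇒≱ q≥2 ℕ.≤-refl
      ... | inj₂ q≡r  = q≢r q≡r

  primeDivisor : ∀ n → 2 ≤ n → ∃ λ q → Prime q × q ∣ n
  primeDivisor (suc zero) (s≤s ())
  primeDivisor n@(suc (suc _)) _ with factorise n
  ... | record { factors = [] ; isFactorisation = () }
  ... | record { factors = q ∷ _ ; isFactorisation = n≡ ; factorsPrime = q-prime ∷ _ } =
    q , q-prime , subst (q ∣_) (sym n≡) (m∣m*n _)

  val-injective : ∀ {m n} → 1 ≤ m → 1 ≤ n → (∀ q → Prime q → val q m ≡ val q n) → m ≡ n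
  val-injective {m} = injective (<-wellFounded m)
    where
    injective : ∀ {m n} → Acc _<_ m → 1 ≤ m → 1 ≤ n → (∀ q → Prime q → val q m ≡ val q n) → m ≡ n
    injective {1} {1}               _ _ _ _ = refl
    injective {1} {n@(suc (suc _))} _ _ _ vals-agree
      with q , q-prime , q∣n ← primeDivisor n (s≤s (s≤s z≤n)) =
      ⊥-elim (ℕ.<⇒≱ (∣⇒val≥1 q≥2 (s≤s z≤n) q∣n)
                     (ℕ.≤-reflexive (trans (sym (vals-agree q q-prime)) (val-1 q≥2))))
      where q≥2 = prime⇒≥2 q-prime
    injective {m@(suc (suc _))} {n} (acc smaller) m≥1 n≥1 vals-agree
      with primeDivisor m (s≤s (s≤s z≤n))
    ... | q , q-prime , q∣m@(divides m′ m≡m′q)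
      with val≥1⇒∣ (prime⇒≥2 q-prime)
             (subst (1 ≤_) (vals-agree q q-prime) (∣⇒val≥1 (prime⇒≥2 q-prime) m≥1 q∣m))
    ... | divides n′ n≡n′q =
      trans m≡m′q (trans (cong (_* q) (injective (smaller m′<m) m′≥1 n′≥1 quotients-agree)) (sym n≡n′q))
      where
      q≥2 = prime⇒≥2 q-prime
      m′≥1 : 1 ≤ m′
      m′≥1 = ≡*q⇒≥1 m≡m′q m≥1
      n′≥1 : 1 ≤ n′
      n′≥1 = ≡*q⇒≥1 n≡n′q n≥1
      m′<m : m′ < m
      m′<m = subst (m′ <_) (sym m≡m′q) (ℕ.m<m*n m′ q q≥2)
        where instance _ = ℕ.>-nonZero m′≥1
      quotients-agree : ∀ r → Prime r → val r m′ ≡ val r n′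
      quotients-agree r r-prime = ℕ.+-cancelʳ-≡ (val r q) (val r m′) (val r n′) (begin
        val r m′ + val r q   ≡⟨ sym (val-* r-prime m′≥1 q≥1) ⟩
        val r (m′ * q)       ≡⟨ cong (val r) (sym m≡m′q) ⟩
        val r m              ≡⟨ vals-agree r r-prime ⟩
        val r n              ≡⟨ cong (val r) n≡n′q ⟩
        val r (n′ * q)       ≡⟨ val-* r-prime n′≥1 q≥1 ⟩
        val r n′ + val r q   ∎)
        where
        open ≡-Reasoning
        q≥1 : 1 ≤ q
        q≥1 = ℕ.≤-trans (s≤s z≤n) q≥2

module Monomial where

  open import Data.Nat.Base as ℕ using (ℕ; zero; suc; _+_; _*_; _^_; _≤_; z≤n; s≤s; NonZero)
  import Data.Nat.Properties as ℕ
  open import Data.Nat.DivMod using (_%_)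
  open import Data.Nat.ListAction using (sum)
  open import Data.Nat.Primality using (Prime)
  open import Data.Nat.Tactic.RingSolver using (solve-∀)
  open import Data.List.Base using (List; []; _∷_; length; map)
  open import Data.List.Relation.Unary.All using (All; []; _∷_)
  open import Data.List.Relation.Binary.Pointwise using (Pointwise; []; _∷_)
  open import Relation.Binary.PropositionalEquality
  open Modular
  open Valuation

  monomial : List ℕ → List ℕ → ℕ
  monomial _        []       = 1
  monomial []       (_ ∷ _)  = 1
  monomial (b ∷ bs) (e ∷ es) = b ^ e * monomial bs es

  dot : List ℕ → List ℕ → ℕ
  dot []       _        = 0
  dot (_ ∷ _)  []       = 0
  dot (e ∷ es) (v ∷ vs) = e * v + dot es vs

  dot-zeroʳ : ∀ es {vs} → All (_≡ 0) vs → dot es vs ≡ 0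
  dot-zeroʳ []       _                      = refl
  dot-zeroʳ (_ ∷ _)  []                     = refl
  dot-zeroʳ (e ∷ es) {_ ∷ vs} (refl ∷ vs≡0) = trans (cong (_+ dot es vs) (ℕ.*-zeroʳ e)) (dot-zeroʳ es vs≡0)

  *-^-distrib : ∀ e a b → (a * b) ^ e ≡ a ^ e * b ^ e
  *-^-distrib zero    a b = refl
  *-^-distrib (suc e) a b = trans (cong ((a * b) *_) (*-^-distrib e a b)) (interchange a b (a ^ e) (b ^ e))
    where interchange : ∀ w x y z → (w * x) * (y * z) ≡ (w * y) * (x * z)
          interchange = solve-∀

  monomial≥1 : ∀ {bs} es → All (1 ≤_) bs → 1 ≤ monomial bs es
  monomial≥1 (e ∷ es) (b≥1 ∷ bs≥1) = ℕ.*-mono-≤ (ℕ.m^n>0 _ e) (monomial≥1 es bs≥1)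
    where instance _ = ℕ.>-nonZero b≥1
  monomial≥1 []       _            = s≤s z≤n
  monomial≥1 (_ ∷ _)  []           = s≤s z≤n

  monomial≤ : ∀ {k bs} es → 1 ≤ k → All (_≤ k) bs → monomial bs es ≤ k ^ sum es
  monomial≤ {k} (e ∷ es) k≥1 (b≤k ∷ bs≤k) =
    ℕ.≤-trans (ℕ.*-mono-≤ (ℕ.^-monoˡ-≤ e b≤k) (monomial≤ es k≥1 bs≤k))
              (ℕ.≤-reflexive (sym (ℕ.^-distribˡ-+-* k e (sum es))))
  monomial≤ []           _   _            = s≤s z≤n
  monomial≤ {k} (e ∷ es) k≥1 []           = ℕ.m^n>0 k (e + sum es)
    where instance _ = ℕ.>-nonZero k≥1

  val-monomial : ∀ {q} → Prime q → ∀ {bs} es → All (1 ≤_) bs → val q (monomial bs es) ≡ dot es (map (val q) bs)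
  val-monomial {q} q-prime {b ∷ bs} (e ∷ es) (b≥1 ∷ bs≥1) =
    trans (val-* q-prime (ℕ.m^n>0 b e) (monomial≥1 es bs≥1))
          (cong₂ _+_ (val-^ q-prime e b≥1) (val-monomial q-prime es bs≥1))
    where instance _ = ℕ.>-nonZero b≥1
  val-monomial q-prime []      _  = val-1 (prime⇒≥2 q-prime)
  val-monomial q-prime (_ ∷ _) [] = val-1 (prime⇒≥2 q-prime)

  monomial-scale : ∀ a {gs} es → length es ≡ length gs → monomial (map (a *_) gs) es ≡ a ^ sum es * monomial gs es
  monomial-scale a {g ∷ gs} (e ∷ es) len≡ = begin
    (a * g) ^ e * monomial (map (a *_) gs) es
      ≡⟨ cong₂ _*_ (*-^-distrib e a g) (monomial-scale a es (ℕ.suc-injective len≡)) ⟩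
    (a ^ e * g ^ e) * (a ^ sum es * monomial gs es)
      ≡⟨ interchange (a ^ e) (g ^ e) (a ^ sum es) (monomial gs es) ⟩
    (a ^ e * a ^ sum es) * (g ^ e * monomial gs es)
      ≡⟨ cong (_* (g ^ e * monomial gs es)) (ℕ.^-distribˡ-+-* a e (sum es)) ⟨
    a ^ (e + sum es) * (g ^ e * monomial gs es)      ∎
    where
    open ≡-Reasoning
    interchange : ∀ w x y z → (w * x) * (y * z) ≡ (w * y) * (x * z)
    interchange = solve-∀
  monomial-scale a {[]} [] _ = refl

  module _ {p : ℕ} where

    monomial-cong-≡± : ∀ {xs ys} → Pointwise (λ x y → x ≡± y mod p) xs ys → ∀ es →
                       monomial xs es ≡± monomial ys es mod p
    monomial-cong-≡± (x≡±y ∷ xs≡±ys) (e ∷ es) = ≡±-* (≡±-^ e x≡±y) (monomial-cong-≡± xs≡±ys es)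
    monomial-cong-≡± []              es       = ≡±-refl
    monomial-cong-≡± (_ ∷ _)         []       = ≡±-refl

  module _ {p : ℕ} .{{_ : NonZero p}} where

    monomial-unity : ∀ {t gs} → All (λ g → (g ^ t) % p ≡ 1 % p) gs → ∀ es → (monomial gs es ^ t) % p ≡ 1 % p
    monomial-unity {t} _  []      = cong (_% p) (ℕ.^-zeroˡ t)
    monomial-unity {t} [] (_ ∷ _) = cong (_% p) (ℕ.^-zeroˡ t)
    monomial-unity {t} {g ∷ gs} (gᵗ≡1 ∷ gsᵗ≡1) (e ∷ es) = begin
      ((g ^ e * M) ^ t) % p        ≡⟨ cong (_% p) (*-^-distrib t (g ^ e) M) ⟩
      ((g ^ e) ^ t * M ^ t) % p    ≡⟨ cong (λ x → (x * M ^ t) % p) (^-comm e t) ⟩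
      ((g ^ t) ^ e * M ^ t) % p    ≡⟨ *-cong-% (trans (^-cong-% e gᵗ≡1) (cong (_% p) (ℕ.^-zeroˡ e)))
                                              (monomial-unity {t} gsᵗ≡1 es) ⟩
      (1 * 1) % p                  ∎
      where
      open ≡-Reasoning
      M = monomial gs es
      ^-comm : ∀ e t → (g ^ e) ^ t ≡ (g ^ t) ^ e
      ^-comm e t = trans (ℕ.^-*-assoc g e t) (trans (cong (g ^_) (ℕ.*-comm e t)) (sym (ℕ.^-*-assoc g t e)))

module Elimination where

  open import Data.Nat.Base as ℕ using (ℕ; zero; suc; _≤_; z≤n; s≤s)
  import Data.Nat.Properties as ℕ
  open import Data.Integer.Base using (ℤ; +_; _+_; _*_; _-_; NonZero; ≢-nonZero)
  open import Data.Integer.Properties as ℤ using (_≟_)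
  open import Data.Integer.Tactic.RingSolver using (solve-∀)
  open import Data.List.Base using (List; []; _∷_; length; map)
  open import Data.List.Properties using (length-map)
  open import Data.List.Relation.Unary.All as All using (All; []; _∷_; all?)
  open import Data.List.Relation.Unary.All.Properties using (¬All⇒Any¬)
  open import Data.List.Membership.Propositional using (_∈_; find)
  open import Data.List.Membership.Propositional.Properties using (∈-map⁺)
  open import Data.Sum.Base using (_⊎_; inj₁; inj₂)
  open import Data.Product.Base using (∃; ∃₂; _×_; _,_)
  open import Relation.Nullary using (yes; no)
  open import Relation.Binary.PropositionalEquality
  open Lists

  Vector : Set
  Vector = ℕ → ℤ

  combination : List ℕ → List Vector → Vector
  combination []       _        i = + 0
  combination (_ ∷ _)  []       i = + 0
  combination (e ∷ es) (b ∷ bs) i = + e * b i + combination es bs i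

  -- Clears coordinate j of v using the pivot a (with a j ≢ 0).
  project : Vector → ℕ → Vector → Vector
  project a j v i = a j * v i - v j * a i

  private
    project-nil : ∀ x y → x * + 0 - + 0 * y ≡ + 0
    project-nil = solve-∀

    +-cancelʳ : ∀ x y z → x + z ≡ y + z → x ≡ y
    +-cancelʳ x y z eq = trans (sym (lemma x z)) (trans (cong (_- z) eq) (lemma y z))
      where lemma : ∀ x z → (x + z) - z ≡ x
            lemma = solve-∀

    -‿cancelʳ : ∀ x y z → x - z ≡ y - z → x ≡ y
    -‿cancelʳ x y z eq = trans (sym (lemma x z)) (trans (cong (_+ z) eq) (lemma y z))
      where lemma : ∀ x z → (x - z) + z ≡ x
            lemma = solve-∀

  project-combination : ∀ a j es bs i → project a j (combination es bs) i ≡ combination es (map (project a j) bs) i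
  project-combination a j []       _        i = project-nil (a j) (a i)
  project-combination a j (_ ∷ _)  []       i = project-nil (a j) (a i)
  project-combination a j (e ∷ es) (b ∷ bs) i =
    trans (lemma (a j) (a i) (+ e) (b i) (b j) (combination es bs i) (combination es bs j))
          (cong (_+_ (+ e * project a j b i)) (project-combination a j es bs i))
    where lemma : ∀ c aᵢ e bᵢ bⱼ r rⱼ →
                  c * (e * bᵢ + r) - (e * bⱼ + rⱼ) * aᵢ ≡ e * (c * bᵢ - bⱼ * aᵢ) + (c * r - rⱼ * aᵢ)
          lemma = solve-∀

  project-self : ∀ a j i → project a j a i ≡ + 0
  project-self a j i = lemma (a j) (a i)
    where lemma : ∀ x y → x * y - x * y ≡ + 0
          lemma = solve-∀

  module _ (Q : List ℕ) where

    infix 4 _≈_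
    _≈_ : Vector → Vector → Set
    u ≈ v = All (λ i → u i ≡ v i) Q

    Independent : List Vector → Set
    Independent B = ∀ e f → length e ≡ length B → length f ≡ length B →
                    combination e B ≈ combination f B → e ≡ f

    DeterminedOn : List Vector → List ℕ → Set
    DeterminedOn A J = ∀ {u v} → u ∈ A → v ∈ A → All (λ j → u j ≡ v j) J → u ≈ v

    private
      pivot? : ∀ A → (∃₂ λ (a : Vector) j → a ∈ A × j ∈ Q × a j ≢ + 0)
                   ⊎ All (λ a → All (λ j → a j ≡ + 0) Q) A
      pivot? A with all? (λ a → all? (λ j → a j ≟ + 0) Q) A
      ... | yes A≡0 = inj₂ A≡0
      ... | no  A≢0 with a , a∈A , a≢0 ← find (¬All⇒Any¬ (λ a → all? (λ j → a j ≟ + 0) Q) A A≢0)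
                    with j , j∈Q , aⱼ≢0 ← find (¬All⇒Any¬ (λ j → a j ≟ + 0) Q a≢0)
                    = inj₁ (a , j , a∈A , j∈Q , aⱼ≢0)

      module Pivot (a : Vector) (j : ℕ) (j∈Q : j ∈ Q) (aⱼ≢0 : a j ≢ + 0) where

        instance
          aⱼ-nonZero : NonZero (a j)
          aⱼ-nonZero = ≢-nonZero aⱼ≢0

        project-cong : ∀ {u v} → u ≈ v → project a j u ≈ project a j v
        project-cong {u} {v} u≈v =
          All.map (λ uᵢ≡vᵢ → cong₂ (λ x y → a j * x - y * _) uᵢ≡vᵢ (All.lookup u≈v j∈Q)) u≈v

        independent-singleton : Independent (a ∷ [])
        independent-singleton (e ∷ []) (f ∷ []) _ _ eq =
          cong (_∷ []) (ℤ.+-injective (ℤ.*-cancelʳ-≡ (+ e) (+ f) (a j) (+-cancelʳ _ _ (+ 0) (All.lookup eq j∈Q))))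

        determined-lift : ∀ {A} J → DeterminedOn (map (project a j) A) J → DeterminedOn A (j ∷ J)
        determined-lift J det {u} {v} u∈A v∈A (uⱼ≡vⱼ ∷ agree) =
          All.map (λ {i} → unproject i) (det (∈-map⁺ (project a j) u∈A) (∈-map⁺ (project a j) v∈A) agree′)
          where
          agree′ : All (λ i → project a j u i ≡ project a j v i) J
          agree′ = All.map (λ uᵢ≡vᵢ → cong₂ (λ x y → a j * x - y * _) uᵢ≡vᵢ uⱼ≡vⱼ) agree
          unproject : ∀ i → project a j u i ≡ project a j v i → u i ≡ v i
          unproject i eq = ℤ.*-cancelˡ-≡ (a j) (u i) (v i)
            (-‿cancelʳ _ _ (u j * a i) (trans eq (cong (λ y → a j * v i - y * a i) (sym uⱼ≡vⱼ))))

        independent-lift : ∀ B → Independent (map (project a j) B) → Independent (a ∷ B)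
        independent-lift B indep (e ∷ es) (f ∷ fs) |e|≡ |f|≡ eq = cong₂ _∷_ e≡f es≡fs
          where
          drop-pivot : ∀ e es i → project a j (combination (e ∷ es) (a ∷ B)) i ≡ combination es (map (project a j) B) i
          drop-pivot e es i = trans (project-combination a j (e ∷ es) (a ∷ B) i)
            (trans (cong (λ x → + e * x + combination es (map (project a j) B) i) (project-self a j i)) (lemma (+ e) _))
            where lemma : ∀ x y → x * + 0 + y ≡ y
                  lemma = solve-∀
          |B| = length-map (project a j) B
          es≡fs : es ≡ fs
          es≡fs = indep es fs (trans (ℕ.suc-injective |e|≡) (sym |B|)) (trans (ℕ.suc-injective |f|≡) (sym |B|))
            (All.map (λ {i} x → trans (sym (drop-pivot e es i)) (trans x (drop-pivot f fs i))) (project-cong eq))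
          e≡f : e ≡ f
          e≡f = ℤ.+-injective (ℤ.*-cancelʳ-≡ (+ e) (+ f) (a j) (+-cancelʳ _ _ (combination es B j)
                  (trans (All.lookup eq j∈Q) (cong (λ gs → + f * a j + combination gs B j) (sym es≡fs)))))

    elimination : ∀ s A → (∃ λ J → length J ≤ s × All (_∈ Q) J × DeterminedOn A J)
                        ⊎ (∃ λ B → length B ≡ suc s × All (_∈ A) B × Independent B)
    elimination s A with pivot? A
    ... | inj₂ A≡0 = inj₁ ([] , z≤n , [] , λ u∈A v∈A _ →
            All.zipWith (λ (uᵢ≡0 , vᵢ≡0) → trans uᵢ≡0 (sym vᵢ≡0))
                        (All.lookup A≡0 u∈A , All.lookup A≡0 v∈A))
    elimination zero    A | inj₁ (a , j , a∈A , j∈Q , aⱼ≢0) =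
      inj₂ (a ∷ [] , refl , a∈A ∷ [] , Pivot.independent-singleton a j j∈Q aⱼ≢0)
    elimination (suc s) A | inj₁ (a , j , a∈A , j∈Q , aⱼ≢0) with elimination s (map (project a j) A)
    ... | inj₁ (J , |J|≤s , J⊆Q , det) =
      inj₁ (j ∷ J , s≤s |J|≤s , j∈Q ∷ J⊆Q , Pivot.determined-lift a j j∈Q aⱼ≢0 J det)
    ... | inj₂ (B′ , |B′|≡ , B′⊆ , indep) with map-preimage (project a j) B′ B′⊆
    ...   | B , refl , B⊆A =
      inj₂ (a ∷ B , cong suc (trans (sym (length-map (project a j) B)) |B′|≡) , a∈A ∷ B⊆A ,
            Pivot.independent-lift a j j∈Q aⱼ≢0 B indep)

module Primes where

  open import Data.Nat.Base as ℕ using (ℕ; zero; suc; _+_; _≤_; _<_; z≤n; s≤s; _!)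
  import Data.Nat.Properties as ℕ
  open import Data.Nat.Divisibility using (_∣_; divides; ∣-trans; m∣m*n; m≤n⇒m!∣n!; ∣⇒≤; ∣m+n∣m⇒∣n)
  open import Data.Nat.Primality using (Prime; prime?; prime⇒irreducible)
  open import Data.Sum.Base using (inj₁; inj₂)
  open import Data.Product.Base using (∃; _×_; _,_)
  open import Data.Empty using (⊥-elim)
  open import Relation.Nullary using (yes; no)
  open import Relation.Binary.PropositionalEquality
  open import Defs using (findPrime; nthPrime)
  open Valuation using (prime⇒≥2; primeDivisor)

  findPrime-≥ : ∀ f n → n ≤ findPrime f n
  findPrime-≥ zero    n = ℕ.≤-refl
  findPrime-≥ (suc f) n with prime? n
  ... | yes _ = ℕ.≤-refl
  ... | no  _ = ℕ.≤-trans (ℕ.n≤1+n n) (findPrime-≥ f (suc n))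

  findPrime-minimal : ∀ f n {q} → Prime q → n ≤ q → findPrime f n ≤ q
  findPrime-minimal zero    n _       n≤q = n≤q
  findPrime-minimal (suc f) n q-prime n≤q with prime? n | ℕ.m≤n⇒m<n∨m≡n n≤q
  ... | yes _       | _        = n≤q
  ... | no  _       | inj₁ n<q = findPrime-minimal f (suc n) q-prime n<q
  ... | no  ¬prime  | inj₂ refl = ⊥-elim (¬prime q-prime)

  findPrime-prime : ∀ f n {q} → Prime q → n ≤ q → q < n + f → Prime (findPrime f n)
  findPrime-prime zero    n _       n≤q q<n+0 = ⊥-elim (ℕ.<⇒≱ q<n+0 (subst (_≤ _) (sym (ℕ.+-identityʳ n)) n≤q))
  findPrime-prime (suc f) n {q} q-prime n≤q q<n+f with prime? n | ℕ.m≤n⇒m<n∨m≡n n≤q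
  ... | yes n-prime | _         = n-prime
  ... | no  _       | inj₁ n<q  = findPrime-prime f (suc n) q-prime n<q (subst (q <_) (ℕ.+-suc n f) q<n+f)
  ... | no  ¬prime  | inj₂ refl = ⊥-elim (¬prime q-prime)

  nthPrime-< : ∀ j → nthPrime j < nthPrime (suc j)
  nthPrime-< j = findPrime-≥ (nthPrime j !) (suc (nthPrime j))

  nthPrime-mono : ∀ {i j} → i ≤ j → nthPrime i ≤ nthPrime j
  nthPrime-mono {j = zero}  z≤n = ℕ.≤-refl
  nthPrime-mono {i} {suc j} i≤1+j with ℕ.m≤n⇒m<n∨m≡n i≤1+j
  ... | inj₁ (s≤s i≤j) = ℕ.≤-trans (nthPrime-mono {i} {j} i≤j) (ℕ.<⇒≤ (nthPrime-< j))
  ... | inj₂ refl      = ℕ.≤-refl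

  nthPrime≥1 : ∀ j → 1 ≤ nthPrime j
  nthPrime≥1 j = nthPrime-mono {0} {j} z≤n

  nthPrime-minimal : ∀ j {q} → Prime q → nthPrime j < q → nthPrime (suc j) ≤ q
  nthPrime-minimal j q-prime = findPrime-minimal (nthPrime j !) (suc (nthPrime j)) q-prime

  private
    ∣! : ∀ {q m} → 1 ≤ q → q ≤ m → q ∣ m !
    ∣! {suc q} _ q≤m = ∣-trans (m∣m*n (q !)) (m≤n⇒m!∣n! q≤m)

  -- Euclid: a prime factor of m ! + 1 lies in (m , m ! + 1], the range searched by findPrime.
  nthPrime-prime : ∀ j → Prime (nthPrime (suc j))
  nthPrime-prime j = prime-in-range (primeDivisor (m ! + 1) 2≤m!+1)
    where
    m = nthPrime j
    2≤m!+1 = ℕ.+-monoˡ-≤ 1 (ℕ.1≤n! m)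
    instance _ = ℕ.>-nonZero (ℕ.≤-trans (s≤s z≤n) 2≤m!+1)
    prime-in-range : (∃ λ q → Prime q × q ∣ m ! + 1) → Prime (nthPrime (suc j))
    prime-in-range (q , q-prime , q∣m!+1) = findPrime-prime (m !) (suc m) q-prime m<q q<1+m+m!
      where
      q≥2 = prime⇒≥2 q-prime
      m<q : m < q
      m<q = ℕ.≰⇒> λ q≤m →
        ℕ.<⇒≱ q≥2 (∣⇒≤ (∣m+n∣m⇒∣n q∣m!+1 (∣! (ℕ.≤-trans (s≤s z≤n) q≥2) q≤m)))
      q<1+m+m! : q < suc m + m !
      q<1+m+m! = s≤s (begin
        q          ≤⟨ ∣⇒≤ q∣m!+1 ⟩
        m ! + 1    ≡⟨ ℕ.+-comm (m !) 1 ⟩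
        1 + m !    ≤⟨ ℕ.+-monoˡ-≤ (m !) (nthPrime≥1 j) ⟩
        m + m !    ∎)
        where open ℕ.≤-Reasoning

  2*n≤p⇒2*n<p : ∀ {p n} → Prime p → 2 < p → 2 ℕ.* n ≤ p → 2 ℕ.* n < p
  2*n≤p⇒2*n<p {p} {n} p-prime 2<p 2n≤p with ℕ.m≤n⇒m<n∨m≡n 2n≤p
  ... | inj₁ 2n<p = 2n<p
  ... | inj₂ 2n≡p with prime⇒irreducible p-prime (divides n (trans (sym 2n≡p) (ℕ.*-comm 2 n)))
  ...   | inj₁ ()
  ...   | inj₂ 2≡p = ⊥-elim (ℕ.<-irrefl 2≡p 2<p)

module SmoothEncoding where

  open import Data.Bool.Base using (T; not; _∧_; _∨_)
  open import Data.Bool using (T?)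
  open import Data.Nat.Base as ℕ using (ℕ; zero; suc; _+_; _*_; _^_; _≤_; _<_; z≤n; s≤s; _≤ᵇ_)
  import Data.Nat.Properties as ℕ
  open import Data.Nat.Divisibility using (_∣_; _∣?_; _∣0; ∣⇒≤; 1∣_; *-monoʳ-∣; ∣1⇒≡1)
  open import Data.Nat.Primality using (Prime; prime?; euclidsLemma; prime⇒irreducible)
  open import Data.List.Base using (List; []; _∷_; length; map; filter; filterᵇ; upTo)
  open import Data.List.Properties using (length-map)
  open import Data.List.Relation.Unary.All as All using (All; []; _∷_)
  open import Data.List.Relation.Unary.All.Properties using (all⁻; all-filter; filter⁺)
  open import Data.List.Relation.Unary.AllPairs as AllPairs using (AllPairs; []; _∷_)
  import Data.List.Relation.Unary.AllPairs.Properties as AllPairs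
  open import Data.List.Relation.Unary.Unique.Propositional using (Unique)
  open import Data.List.Membership.Propositional using (_∈_)
  open import Data.List.Membership.Propositional.Properties
    using (∈-map⁺; ∈-map⁻; ∈-upTo⁺; ∈-filter⁺; ∈-filter⁻)
  open import Data.List.Membership.DecPropositional ℕ._≟_ using (_∈?_)
  open import Data.Sum.Base using (inj₁; inj₂)
  open import Data.Product.Base using (_×_; _,_; proj₁; proj₂)
  open import Data.Empty using (⊥-elim)
  open import Relation.Nullary using (yes; no)
  open import Relation.Nullary.Decidable using (⌊_⌋)
  open import Function.Base using (_∘_; id)
  open import Relation.Binary.PropositionalEquality
  open import Defs using (nthPrime; smoothᵇ; Ψ)
  open Lists
  open Valuation
  open Primes

  PrimesAbove : ℕ → List ℕ → Set
  PrimesAbove j qs = All Prime qs × AllPairs _<_ qs × All (nthPrime j <_) qs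

  -- Moves the exponent of the i-th prime of qs onto the (j+i)-th prime.
  encode : ℕ → List ℕ → ℕ → ℕ
  encode j []       h = 1
  encode j (q ∷ qs) h = nthPrime (suc j) ^ val q h * encode (suc j) qs h

  primePart : List ℕ → ℕ → ℕ
  primePart []       h = 1
  primePart (q ∷ qs) h = q ^ val q h * primePart qs h

  encode≥1 : ∀ j qs h → 1 ≤ encode j qs h
  encode≥1 j []       h = s≤s z≤n
  encode≥1 j (q ∷ qs) h = ℕ.*-mono-≤ (ℕ.m^n>0 _ (val q h)) (encode≥1 (suc j) qs h)
    where instance _ = ℕ.>-nonZero (nthPrime≥1 (suc j))

  encode≤primePart : ∀ j qs h → PrimesAbove j qs → encode j qs h ≤ primePart qs h
  encode≤primePart j []       h _ = ℕ.≤-refl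
  encode≤primePart j (q ∷ qs) h (q-prime ∷ qs-prime , q<qs ∷ sorted , pⱼ<q ∷ pⱼ<qs) =
    ℕ.*-mono-≤ (ℕ.^-monoˡ-≤ (val q h) pⱼ₊₁≤q)
               (encode≤primePart (suc j) qs h (qs-prime , sorted , All.map (ℕ.≤-<-trans pⱼ₊₁≤q) q<qs))
    where pⱼ₊₁≤q = nthPrime-minimal j q-prime pⱼ<q

  primePart∣ : ∀ qs {h} → 1 ≤ h → All Prime qs → AllPairs _<_ qs → primePart qs h ∣ h
  primePart∣ []       {h} _   _                    _              = 1∣ h
  primePart∣ (q ∷ qs) {h} h≥1 (q-prime ∷ qs-prime) (q<qs ∷ sorted)
    with m , h≡q^v*m , q∤m ← val-decomposition (prime⇒≥2 q-prime) h h≥1 =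
    subst (λ x → q ^ val q h * primePart qs h ∣ x) (sym h≡q^v*m)
      (subst (λ x → q ^ val q h * x ∣ q ^ val q h * m) (sym (primePart-cong qs same-vals))
        (*-monoʳ-∣ (q ^ val q h) (primePart∣ qs m≥1 qs-prime sorted)))
    where
    m≥1 : 1 ≤ m
    m≥1 = ℕ.n≢0⇒n>0 λ m≡0 → q∤m (subst (q ∣_) (sym m≡0) (q ∣0))
    primePart-cong : ∀ qs → All (λ r → val r h ≡ val r m) qs → primePart qs h ≡ primePart qs m
    primePart-cong []       []         = refl
    primePart-cong (r ∷ rs) (v≡ ∷ vs≡) = cong₂ (λ x y → r ^ x * y) v≡ (primePart-cong rs vs≡)
    same-vals : All (λ r → val r h ≡ val r m) qs
    same-vals = All.zipWith (λ {r} (r-prime , q<r) → begin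
      val r h                          ≡⟨ cong (val r) h≡q^v*m ⟩
      val r (q ^ val q h * m)          ≡⟨ val-* r-prime (ℕ.m^n>0 q (val q h)) m≥1 ⟩
      val r (q ^ val q h) + val r m    ≡⟨ cong (_+ val r m) (val-^ r-prime (val q h) q≥1) ⟩
      val q h * val r q + val r m
        ≡⟨ cong (λ x → val q h * x + val r m) (val-prime r-prime q-prime (ℕ.>⇒≢ q<r)) ⟩
      val q h * 0 + val r m            ≡⟨ cong (_+ val r m) (ℕ.*-zeroʳ (val q h)) ⟩
      val r m                          ∎) (qs-prime , q<qs)
      where
      open ≡-Reasoning
      q≥1 = ℕ.≤-trans (s≤s z≤n) (prime⇒≥2 q-prime)
      instance _ = ℕ.>-nonZero q≥1

  private
    val-encode-∷ : ∀ {r} → Prime r → ∀ j q qs h →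
                   val r (encode j (q ∷ qs) h) ≡ val q h * val r (nthPrime (suc j)) + val r (encode (suc j) qs h)
    val-encode-∷ {r} r-prime j q qs h =
      trans (val-* r-prime (ℕ.m^n>0 (nthPrime (suc j)) (val q h)) (encode≥1 (suc j) qs h))
            (cong (_+ val r (encode (suc j) qs h)) (val-^ r-prime (val q h) (nthPrime≥1 (suc j))))
      where instance _ = ℕ.>-nonZero (nthPrime≥1 (suc j))

  val-encode : ∀ {r} → Prime r → ∀ j qs h → r ≤ nthPrime j → val r (encode j qs h) ≡ 0
  val-encode r-prime j []       h _    = val-1 (prime⇒≥2 r-prime)
  val-encode {r} r-prime j (q ∷ qs) h r≤pⱼ = begin
    val r (encode j (q ∷ qs) h)                                 ≡⟨ val-encode-∷ r-prime j q qs h ⟩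
    val q h * val r (nthPrime (suc j)) + val r (encode (suc j) qs h)
      ≡⟨ cong₂ (λ x y → val q h * x + y) (val-prime r-prime (nthPrime-prime j) r≢pⱼ₊₁)
                                          (val-encode r-prime (suc j) qs h r≤pⱼ₊₁) ⟩
    val q h * 0 + 0                                             ≡⟨ cong (_+ 0) (ℕ.*-zeroʳ (val q h)) ⟩
    0                                                           ∎
    where
    open ≡-Reasoning
    r≤pⱼ₊₁ : r ≤ nthPrime (suc j)
    r≤pⱼ₊₁ = ℕ.≤-trans r≤pⱼ (ℕ.<⇒≤ (nthPrime-< j))
    r≢pⱼ₊₁ : r ≢ nthPrime (suc j)
    r≢pⱼ₊₁ r≡pⱼ₊₁ = ℕ.<⇒≱ (nthPrime-< j) (subst (_≤ nthPrime j) r≡pⱼ₊₁ r≤pⱼ)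

  encode-injective : ∀ j qs {h h′} → encode j qs h ≡ encode j qs h′ → All (λ q → val q h ≡ val q h′) qs
  encode-injective j []       _  = []
  encode-injective j (q ∷ qs) {h} {h′} eq = vals≡ ∷ encode-injective (suc j) qs rests≡
    where
    P = nthPrime (suc j)
    P-prime = nthPrime-prime j
    val-P : ∀ x → val P (encode j (q ∷ qs) x) ≡ val q x
    val-P x = begin
      val P (encode j (q ∷ qs) x)                    ≡⟨ val-encode-∷ P-prime j q qs x ⟩
      val q x * val P P + val P (encode (suc j) qs x) ≡⟨ cong₂ (λ y z → val q x * y + z) (val-self (prime⇒≥2 P-prime))
                                                               (val-encode P-prime (suc j) qs x ℕ.≤-refl) ⟩
      val q x * 1 + 0                                ≡⟨ trans (ℕ.+-identityʳ _) (ℕ.*-identityʳ (val q x)) ⟩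
      val q x                                        ∎
      where open ≡-Reasoning
    vals≡ : val q h ≡ val q h′
    vals≡ = trans (sym (val-P h)) (trans (cong (val P) eq) (val-P h′))
    rests≡ : encode (suc j) qs h ≡ encode (suc j) qs h′
    rests≡ = ℕ.*-cancelˡ-≡ _ _ (P ^ val q h) (trans eq (cong (λ v → P ^ v * encode (suc j) qs h′) (sym vals≡)))
      where instance _ = ℕ.m^n≢0 P (val q h) {{ℕ.>-nonZero (nthPrime≥1 (suc j))}}

  private
    prime∣^⇒∣ : ∀ {r} → Prime r → ∀ {P} a → r ∣ P ^ a → r ∣ P
    prime∣^⇒∣ r-prime zero    r∣1 = ⊥-elim (ℕ.<⇒≱ (prime⇒≥2 r-prime) (ℕ.≤-reflexive (∣1⇒≡1 r∣1)))
    prime∣^⇒∣ r-prime {P} (suc a) r∣P^a with euclidsLemma P (P ^ a) r-prime r∣P^a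
    ... | inj₁ r∣P   = r∣P
    ... | inj₂ r∣P^a = prime∣^⇒∣ r-prime a r∣P^a

  encode-smooth : ∀ {r} → Prime r → ∀ j qs h → r ∣ encode j qs h → r ≤ nthPrime (j + length qs)
  encode-smooth r-prime j []       h r∣1 = ⊥-elim (ℕ.<⇒≱ (prime⇒≥2 r-prime) (ℕ.≤-reflexive (∣1⇒≡1 r∣1)))
  encode-smooth {r} r-prime j (q ∷ qs) h r∣encode
    with euclidsLemma (nthPrime (suc j) ^ val q h) (encode (suc j) qs h) r-prime r∣encode
  ... | inj₂ r∣rest =
    subst (λ i → r ≤ nthPrime i) (sym (ℕ.+-suc j (length qs))) (encode-smooth r-prime (suc j) qs h r∣rest)
  ... | inj₁ r∣P^v with prime⇒irreducible (nthPrime-prime j) (prime∣^⇒∣ r-prime (val q h) r∣P^v)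
  ...   | inj₁ refl = ⊥-elim (ℕ.<⇒≱ (prime⇒≥2 r-prime) ℕ.≤-refl)
  ...   | inj₂ refl = nthPrime-mono (subst (suc j ≤_) (sym (ℕ.+-suc j (length qs))) (s≤s (ℕ.m≤m+n j (length qs))))

  smooth∈ : ∀ {k y n} → 1 ≤ n → n ≤ k → (∀ {r} → Prime r → r ∣ n → r ≤ y) →
            n ∈ filterᵇ (smoothᵇ y) (map suc (upTo k))
  smooth∈ {k} {y} {suc n} _ n<k smooth =
    ∈-filter⁺ (T? ∘ smoothᵇ y) (∈-map⁺ suc (∈-upTo⁺ n<k))
      (all⁻ _ {upTo (suc (suc n))} (All.tabulate λ {q} _ → factor-ok q))
    where
    factor-ok : ∀ q → T (not (⌊ prime? q ⌋ ∧ ⌊ q ∣? suc n ⌋) ∨ (q ≤ᵇ y))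
    factor-ok q with prime? q | q ∣? suc n
    ... | yes q-prime | yes q∣n = ℕ.≤⇒≤ᵇ (smooth q-prime q∣n)
    ... | yes _       | no  _   = _
    ... | no  _       | _       = _

  length≤Ψ-sorted : ∀ {k s} {H qs : List ℕ} → Unique H → (∀ {h} → h ∈ H → 1 ≤ h × h ≤ k) →
                    All Prime qs → AllPairs _<_ qs → length qs ≤ s →
                    (∀ {h h′} → h ∈ H → h′ ∈ H → All (λ q → val q h ≡ val q h′) qs → h ≡ h′) →
                    length H ≤ Ψ k (nthPrime s)
  length≤Ψ-sorted {k} {s} {H} {qs} unique H-bounds qs-prime qs-sorted |qs|≤s determined = begin
    length H                  ≡⟨ length-map (encode 0 qs) H ⟨
    length (map (encode 0 qs) H) ≤⟨ Unique∧⊆⇒length≤ (Unique-map⁺ (encode 0 qs) encode-injectiveOn unique)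
                                                     encode∈ ⟩
    Ψ k (nthPrime s)          ∎
    where
    open ℕ.≤-Reasoning
    encode-injectiveOn : ∀ {h h′} → h ∈ H → h′ ∈ H → encode 0 qs h ≡ encode 0 qs h′ → h ≡ h′
    encode-injectiveOn h∈H h′∈H eq = determined h∈H h′∈H (encode-injective 0 qs eq)
    encode∈ : ∀ {c} → c ∈ map (encode 0 qs) H → c ∈ filterᵇ (smoothᵇ (nthPrime s)) (map suc (upTo k))
    encode∈ c∈ with h , h∈H , refl ← ∈-map⁻ (encode 0 qs) c∈ =
      smooth∈ (encode≥1 0 qs h) encode≤k
        (λ r-prime r∣code → ℕ.≤-trans (encode-smooth r-prime 0 qs h r∣code) (nthPrime-mono {length qs} {s} |qs|≤s))
      where
      h≥1 = proj₁ (H-bounds h∈H)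
      encode≤k : encode 0 qs h ≤ k
      encode≤k = ℕ.≤-trans (encode≤primePart 0 qs h (qs-prime , qs-sorted , All.map prime⇒≥2 qs-prime))
                   (ℕ.≤-trans (∣⇒≤ (primePart∣ qs h≥1 qs-prime qs-sorted)) (proj₂ (H-bounds h∈H)))
        where instance _ = ℕ.>-nonZero h≥1

  length≤Ψ : ∀ {k s} {H J : List ℕ} → Unique H → (∀ {h} → h ∈ H → 1 ≤ h × h ≤ k) →
             All Prime J → length J ≤ s →
             (∀ {h h′} → h ∈ H → h′ ∈ H → All (λ q → val q h ≡ val q h′) J → h ≡ h′) →
             length H ≤ Ψ k (nthPrime s)
  length≤Ψ {k} {s} {H} {J} unique H-bounds J-prime |J|≤s determined =
    length≤Ψ-sorted unique H-bounds qs-prime qs-sorted |qs|≤s determined-by-qs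
    where
    primes≤k = filter prime? (upTo (suc k))
    qs = filter (_∈? J) primes≤k
    qs-prime : All Prime qs
    qs-prime = filter⁺ (_∈? J) (all-filter prime? (upTo (suc k)))
    qs-sorted : AllPairs _<_ qs
    qs-sorted = AllPairs.filter⁺ (_∈? J) (AllPairs.filter⁺ prime? (AllPairs.applyUpTo⁺₁ id (suc k) λ i<j _ → i<j))
    |qs|≤s : length qs ≤ s
    |qs|≤s = ℕ.≤-trans (Unique∧⊆⇒length≤ (AllPairs.map ℕ.<⇒≢ qs-sorted)
                         (λ q∈qs → proj₂ (∈-filter⁻ (_∈? J) {xs = primes≤k} q∈qs))) |J|≤s
    determined-by-qs : ∀ {h h′} → h ∈ H → h′ ∈ H → All (λ q → val q h ≡ val q h′) qs → h ≡ h′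
    determined-by-qs {h} {h′} h∈H h′∈H agree-qs =
      determined h∈H h′∈H (All.tabulate λ {q} q∈J → agree q (All.lookup J-prime q∈J) q∈J)
      where
      agree : ∀ q → Prime q → q ∈ J → val q h ≡ val q h′
      agree q q-prime q∈J with q ℕ.≤? k
      ... | yes q≤k =
        All.lookup agree-qs (∈-filter⁺ (_∈? J) (∈-filter⁺ prime? (∈-upTo⁺ (s≤s q≤k)) q-prime) q∈J)
      ... | no  q≰k = trans (val-< q≥2 (proj₁ (H-bounds h∈H)) h<q) (sym (val-< q≥2 (proj₁ (H-bounds h′∈H)) h′<q))
        where
        q≥2 = prime⇒≥2 q-prime
        h<q = ℕ.≤-<-trans (proj₂ (H-bounds h∈H)) (ℕ.≰⇒> q≰k)
        h′<q = ℕ.≤-<-trans (proj₂ (H-bounds h′∈H)) (ℕ.≰⇒> q≰k)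

module Heights where

  open import Data.Bool.Base using (T)
  open import Data.Bool using (T?)
  open import Data.Bool.Properties using (T-∧)
  open import Data.Nat.Base as ℕ using (ℕ; suc; _*_; _^_; _∸_; _≤_; _<_; _⊓_; NonZero)
  import Data.Nat.Properties as ℕ
  open import Data.Nat.DivMod using (_%_; m<n⇒m%n≡m)
  open import Data.Nat.Divisibility using (∣⇒≤; ∣-trans; m∣m*n; m%n≡0⇒n∣m; n∣m⇒m%n≡0)
  open import Data.Nat.Primality using (Prime; euclidsLemma)
  open import Data.Nat.GCD using (gcd)
  open import Data.List.Base using (upTo)
  open import Data.List.Relation.Unary.Any.Properties using (any⁻)
  open import Data.List.Relation.Unary.Unique.Propositional using (Unique)
  open import Data.List.Relation.Unary.Unique.DecPropositional.Properties using (deduplicate-!)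
  open import Data.List.Membership.Propositional using (_∈_; find)
  open import Data.List.Membership.Propositional.Properties using (∈-map⁻; ∈-filter⁻; ∈-upTo⁻; ∈-deduplicate⁻)
  open import Data.Sum.Base using (inj₁; inj₂)
  open import Data.Product.Base using (∃; _×_; _,_)
  open import Function.Base using (_∘_)
  open import Function.Bundles using (Equivalence)
  open import Relation.Binary.PropositionalEquality
  open import Defs using (height; inUᵇ; coprimeHeights)
  open Modular

  module _ (p : ℕ) .{{_ : NonZero p}} where

    record InU (k t a x : ℕ) : Set where
      field
        g        : ℕ
        gᵗ≡1     : (g ^ t) % p ≡ 1
        ag≡x     : (a * g) % p ≡ x % p
        height≤k : height p x ≤ k

    inUᵇ⇒InU : ∀ {k t a x} → T (inUᵇ p k t a x) → InU k t a x
    inUᵇ⇒InU {k} {t} {a} {x} x∈U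
      with x∈aG , |x|≤k ← Equivalence.to T-∧ x∈U
      with g , _ , witness ← find (any⁻ _ (upTo p) x∈aG)
      with gᵗ≡1 , ag≡x ← Equivalence.to T-∧ witness =
      record { g        = g
             ; gᵗ≡1     = ℕ.≡ᵇ⇒≡ _ _ gᵗ≡1
             ; ag≡x     = ℕ.≡ᵇ⇒≡ _ _ ag≡x
             ; height≤k = ℕ.≤ᵇ⇒≤ _ _ |x|≤k
             }

    ∈coprimeHeights : ∀ {k t a x₀ h} → h ∈ coprimeHeights p k t a x₀ →
                      ∃ λ x → x < p × InU k t a x × gcd h (height p x₀) ≡ 1 × h ≡ height p x
    ∈coprimeHeights {k} {t} {a} {x₀} h∈
      with x , x∈ , refl ← ∈-map⁻ (height p) (∈-deduplicate⁻ ℕ._≟_ _ h∈)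
      with x∈upTo , selected ← ∈-filter⁻ (T? ∘ _) {xs = upTo p} x∈
      with x∈U , coprime ← Equivalence.to T-∧ selected =
      x , ∈-upTo⁻ x∈upTo , inUᵇ⇒InU x∈U , ℕ.≡ᵇ⇒≡ _ _ coprime , refl

    coprimeHeights-unique : ∀ {k t a x₀} → Unique (coprimeHeights p k t a x₀)
    coprimeHeights-unique = deduplicate-! ℕ._≟_ _

    height-< : ∀ {x} → x < p → height p x ≡ x ⊓ (p ∸ x)
    height-< {x} x<p = cong (λ y → y ⊓ (p ∸ y)) (m<n⇒m%n≡m x<p)

    ≡±height : ∀ {x} → x < p → x ≡± height p x mod p
    ≡±height {x} x<p rewrite height-< x<p with ℕ.≤-total x (p ∸ x)
    ... | inj₁ x≤p-x rewrite ℕ.m≤n⇒m⊓n≡m x≤p-x = ≡±-refl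
    ... | inj₂ p-x≤x rewrite ℕ.m≥n⇒m⊓n≡n p-x≤x = ≡±-complement (ℕ.<⇒≤ x<p)

    height≥1 : ∀ {x} → x < p → x ≢ 0 → 1 ≤ height p x
    height≥1 {x} x<p x≢0 rewrite height-< x<p with ℕ.≤-total x (p ∸ x)
    ... | inj₁ x≤p-x rewrite ℕ.m≤n⇒m⊓n≡m x≤p-x = ℕ.n≢0⇒n>0 x≢0
    ... | inj₂ p-x≤x rewrite ℕ.m≥n⇒m⊓n≡n p-x≤x = ℕ.m<n⇒0<n∸m x<p

    InU⇒≢0 : Prime p → ∀ {k t a x} → 0 < a → a < p → 0 < t → x < p → InU k t a x → x ≢ 0
    InU⇒≢0 p-prime {t = suc t} {a} 0<a a<p _ x<p record { g = g ; gᵗ≡1 = gᵗ≡1 ; ag≡x = ag≡x } refl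
      with euclidsLemma a g p-prime (m%n≡0⇒n∣m (a * g) p ag≡0)
      where ag≡0 = trans ag≡x (m<n⇒m%n≡m x<p)
    ... | inj₁ p∣a = ℕ.<⇒≱ a<p (∣⇒≤ p∣a)
      where instance _ = ℕ.>-nonZero 0<a
    ... | inj₂ p∣g with () ← trans (sym (n∣m⇒m%n≡0 (g ^ suc t) p (∣-trans p∣g (m∣m*n (g ^ t))))) gᵗ≡1

    record ±∈aG (t a h : ℕ) : Set where
      field
        g     : ℕ
        gᵗ≡1  : (g ^ t) % p ≡ 1 % p
        h≡±ag : h ≡± a * g mod p

    InU⇒±∈aG : 1 < p → ∀ {k t a x} → x < p → InU k t a x → ±∈aG t a (height p x)
    InU⇒±∈aG 1<p x<p record { g = g ; gᵗ≡1 = gᵗ≡1 ; ag≡x = ag≡x } = record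
      { g     = g
      ; gᵗ≡1  = trans gᵗ≡1 (sym (m<n⇒m%n≡m 1<p))
      ; h≡±ag = ≡±-trans (≡±-sym (≡±height x<p)) (≡mod⇒≡± (≡mod-sym (%≡⇒≡mod ag≡x)))
      }

module Bound where

  open import Data.Nat.Base as ℕ using (ℕ; suc; _+_; _*_; _∸_; _^_; _≤_; _<_; NonZero; z≤n; s≤s)
  import Data.Nat.Properties as ℕ
  open import Data.Nat.DivMod using (_%_; m%n<n; m%n%n≡m%n)
  open import Data.Nat.Divisibility using (_∣_; ∣1⇒≡1)
  open import Data.Nat.Primality using (Prime; prime?)
  open import Data.Nat.Combinatorics using (_C_)
  open import Data.Nat.GCD using (gcd; gcd-greatest)
  open import Data.Nat.ListAction using (sum)
  open import Data.Integer.Base using (+_)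
  import Data.Integer.Base as ℤ
  import Data.Integer.Properties as ℤ
  open import Data.List.Base using (List; []; _∷_; length; map; filter; upTo)
  open import Data.List.Properties using (length-map)
  open import Data.List.Relation.Unary.All as All using (All; []; _∷_; reduce)
  open import Data.List.Relation.Unary.All.Properties using (map⁺)
  open import Data.List.Relation.Binary.Pointwise using (Pointwise; []; _∷_; Pointwise-length)
  open import Data.List.Membership.Propositional using (_∈_)
  open import Data.List.Membership.Propositional.Properties using (∈-map⁺; ∈-filter⁺; ∈-filter⁻; ∈-upTo⁺)
  open import Data.Sum.Base using (inj₁; inj₂)
  open import Data.Product.Base using (∃; _×_; _,_; proj₁; proj₂)
  open import Data.Empty using (⊥-elim)
  open import Relation.Nullary using (yes; no; ¬_)
  open import Relation.Binary.PropositionalEquality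
  open import Defs
  open Modular
  open PolynomialRoots
  open Lists
  open ExponentVectors
  open Valuation
  open Monomial
  open Elimination
  open Primes
  open SmoothEncoding
  open Heights

  module _ (p : ℕ) .{{_ : NonZero p}} (p-prime : Prime p) (2<p : 2 < p)
               {t : ℕ} (0<t : 0 < t) {k : ℕ} (1<k : 1 < k) {a : ℕ} (0<a : 0 < a) (a<p : a < p)
               {x₀ : ℕ} (x₀<p : x₀ < p) (x₀∈U : InU p k t a x₀)
               {D : ℕ} (2kᴰ≤p : 2 * k ^ D ≤ p) where

    H : List ℕ
    H = coprimeHeights p k t a x₀

    h₀ : ℕ
    h₀ = height p x₀

    private
      1<p : 1 < p
      1<p = ℕ.<-trans (s≤s (s≤s z≤n)) 2<p

      height≥1′ : ∀ {x} → x < p → InU p k t a x → 1 ≤ height p x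
      height≥1′ x<p x∈U = height≥1 p x<p (InU⇒≢0 p p-prime 0<a a<p 0<t x<p x∈U)

      ∈H : ∀ {h} → h ∈ H → ∃ λ x → x < p × InU p k t a x × gcd h h₀ ≡ 1 × h ≡ height p x
      ∈H = ∈coprimeHeights p

    h₀≥1 : 1 ≤ h₀
    h₀≥1 = height≥1′ x₀<p x₀∈U

    h₀≤k : h₀ ≤ k
    h₀≤k = InU.height≤k x₀∈U

    H-bounds : ∀ {h} → h ∈ H → 1 ≤ h × h ≤ k
    H-bounds h∈H with x , x<p , x∈U , _ , refl ← ∈H h∈H = height≥1′ x<p x∈U , InU.height≤k x∈U

    H-coprime : ∀ {h} → h ∈ H → gcd h h₀ ≡ 1
    H-coprime h∈H with _ , _ , _ , coprime , _ ← ∈H h∈H = coprime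

    H-±∈aG : ∀ {h} → h ∈ H → ±∈aG p t a h
    H-±∈aG h∈H with x , x<p , x∈U , _ , refl ← ∈H h∈H = InU⇒±∈aG p 1<p x<p x∈U

    Q : List ℕ
    Q = filter prime? (upTo (suc k))

    ∈Q⇒prime : ∀ {q} → q ∈ Q → Prime q
    ∈Q⇒prime q∈Q = proj₂ (∈-filter⁻ prime? {xs = upTo (suc k)} q∈Q)

    vector : ℕ → Vector
    vector h q = + val q h

    agree-on-Q⇒≡ : ∀ {h h′} → h ∈ H → h′ ∈ H → _≈_ Q (vector h) (vector h′) → h ≡ h′
    agree-on-Q⇒≡ {h} {h′} h∈H h′∈H agree =
      val-injective (proj₁ (H-bounds h∈H)) (proj₁ (H-bounds h′∈H)) vals≡
      where
      vals≡ : ∀ q → Prime q → val q h ≡ val q h′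
      vals≡ q q-prime with q ℕ.≤? k
      ... | yes q≤k = ℤ.+-injective (All.lookup agree (∈-filter⁺ prime? (∈-upTo⁺ (s≤s q≤k)) q-prime))
      ... | no  q≰k = trans (val-< q≥2 (proj₁ (H-bounds h∈H)) h<q) (sym (val-< q≥2 (proj₁ (H-bounds h′∈H)) h′<q))
        where
        q≥2 = prime⇒≥2 q-prime
        h<q = ℕ.≤-<-trans (proj₂ (H-bounds h∈H)) (ℕ.≰⇒> q≰k)
        h′<q = ℕ.≤-<-trans (proj₂ (H-bounds h′∈H)) (ℕ.≰⇒> q≰k)

    determined⇒length≤Ψ : ∀ {s J} → length J ≤ s → All (_∈ Q) J → DeterminedOn Q (map vector H) J →
                          length H ≤ Ψ k (nthPrime s)
    determined⇒length≤Ψ |J|≤s J⊆Q determined =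
      length≤Ψ (coprimeHeights-unique p {k} {t} {a} {x₀}) H-bounds (All.map ∈Q⇒prime J⊆Q) |J|≤s
        λ h∈H h′∈H agree → agree-on-Q⇒≡ h∈H h′∈H
          (determined (∈-map⁺ vector h∈H) (∈-map⁺ vector h′∈H) (All.map (cong (λ n → + n)) agree))

    gs-of : ∀ {hs} → All (_∈ H) hs → List ℕ
    gs-of = reduce (λ h∈H → ±∈aG.g (H-±∈aG h∈H))

    gs-of-≡± : ∀ {hs} (hs⊆H : All (_∈ H) hs) → Pointwise (λ h y → h ≡± y mod p) hs (map (a *_) (gs-of hs⊆H))
    gs-of-≡± []             = []
    gs-of-≡± (h∈H ∷ hs⊆H) = ±∈aG.h≡±ag (H-±∈aG h∈H) ∷ gs-of-≡± hs⊆H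

    gs-of-unity : ∀ {hs} (hs⊆H : All (_∈ H) hs) → All (λ g → (g ^ t) % p ≡ 1 % p) (gs-of hs⊆H)
    gs-of-unity []             = []
    gs-of-unity (h∈H ∷ hs⊆H) = ±∈aG.gᵗ≡1 (H-±∈aG h∈H) ∷ gs-of-unity hs⊆H

    combination-vector : ∀ hs es i → combination es (map vector hs) i ≡ + dot es (map (val i) hs)
    combination-vector hs       []       i = refl
    combination-vector []       (_ ∷ _)  i = refl
    combination-vector (h ∷ hs) (e ∷ es) i =
      trans (cong₂ ℤ._+_ (sym (ℤ.pos-* e (val i h))) (combination-vector hs es i))
            (sym (ℤ.pos-+ (e * val i h) (dot es (map (val i) hs))))

    module IndependentFamily {hs : List ℕ} (hs⊆H : All (_∈ H) hs) (independent : Independent Q (map vector hs)) where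

      n : ℕ
      n = length hs

      h₀-rep : ±∈aG p t a h₀
      h₀-rep = InU⇒±∈aG p 1<p x₀<p x₀∈U

      g₀ : ℕ
      g₀ = ±∈aG.g h₀-rep

      gs : List ℕ
      gs = gs-of hs⊆H

      |hs|≡|gs| : length hs ≡ length gs
      |hs|≡|gs| = trans (Pointwise-length (gs-of-≡± hs⊆H)) (length-map (a *_) gs)

      |e|≡n : ∀ {e} → e ∈ exponents n D → length e ≡ n
      |e|≡n e∈ = proj₁ (∈-exponents {n} {D} e∈)

      Σe≤D : ∀ {e} → e ∈ exponents n D → sum e ≤ D
      Σe≤D e∈ = proj₂ (∈-exponents {n} {D} e∈)

      N G : List ℕ → ℕ
      N e = monomial (h₀ ∷ hs) (homogenise D e)
      G e = monomial (g₀ ∷ gs) (homogenise D e)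

      N≡±aᴰG : ∀ {e} → e ∈ exponents n D → N e ≡± a ^ D * G e mod p
      N≡±aᴰG {e} e∈ = ≡±-trans (monomial-cong-≡± (±∈aG.h≡±ag h₀-rep ∷ gs-of-≡± hs⊆H) (homogenise D e))
                               (≡mod⇒≡± (≡⇒≡mod (cong +_ scale)))
        where
        scale : monomial (map (a *_) (g₀ ∷ gs)) (homogenise D e) ≡ a ^ D * G e
        scale = trans (monomial-scale a (homogenise D e) (cong suc (trans (|e|≡n e∈) |hs|≡|gs|)))
                      (cong (λ m → a ^ m * G e) (sum-homogenise e (Σe≤D e∈)))

      2N<p : ∀ {e} → e ∈ exponents n D → 2 * N e < p
      2N<p {e} e∈ = 2*n≤p⇒2*n<p {p} {N e} p-prime 2<p (ℕ.≤-trans (ℕ.*-monoʳ-≤ 2 N≤kᴰ) 2kᴰ≤p)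
        where
        N≤kᴰ : N e ≤ k ^ D
        N≤kᴰ = subst (N e ≤_) (cong (k ^_) (sum-homogenise e (Σe≤D e∈)))
                 (monomial≤ (homogenise D e) (ℕ.<⇒≤ 1<k)
                    (h₀≤k ∷ All.map (λ h∈H → proj₂ (H-bounds h∈H)) hs⊆H))

      val-N : ∀ {q} → Prime q → ∀ e → val q (N e) ≡ (D ∸ sum e) * val q h₀ + dot e (map (val q) hs)
      val-N q-prime e = val-monomial q-prime (homogenise D e) (h₀≥1 ∷ All.map (λ h∈H → proj₁ (H-bounds h∈H)) hs⊆H)

      -- If h₀ > 1, a prime r ∣ h₀ divides none of hs, so val r reads off the exponent of h₀.
      h₀-parts-agree : ∀ {e f} → N e ≡ N f → ∀ {q} → Prime q →
                       (D ∸ sum e) * val q h₀ ≡ (D ∸ sum f) * val q h₀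
      h₀-parts-agree {e} {f} Ne≡Nf {q} q-prime with ℕ.m≤n⇒m<n∨m≡n h₀≥1
      ... | inj₂ 1≡h₀ = trans (vanishes (D ∸ sum e)) (sym (vanishes (D ∸ sum f)))
        where
        vanishes : ∀ m → m * val q h₀ ≡ 0
        vanishes m = trans (cong (m *_) (subst (λ x → val q x ≡ 0) 1≡h₀ (val-1 (prime⇒≥2 q-prime)))) (ℕ.*-zeroʳ m)
      ... | inj₁ 1<h₀ with r , r-prime , r∣h₀ ← primeDivisor h₀ 1<h₀ =
        cong (_* val q h₀) (ℕ.*-cancelʳ-≡ (D ∸ sum e) (D ∸ sum f) (val r h₀)
          (trans (sym (val-r-N e)) (trans (cong (val r) Ne≡Nf) (val-r-N f))))
        where
        r≥2 = prime⇒≥2 r-prime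
        instance _ = ℕ.>-nonZero (∣⇒val≥1 r≥2 h₀≥1 r∣h₀)
        r∤ : ∀ {h} → h ∈ H → ¬ r ∣ h
        r∤ h∈H r∣h =
          ℕ.<⇒≱ r≥2 (ℕ.≤-reflexive (∣1⇒≡1 (subst (r ∣_) (H-coprime h∈H) (gcd-greatest r∣h r∣h₀))))
        val-r-N : ∀ e → val r (N e) ≡ (D ∸ sum e) * val r h₀
        val-r-N e = trans (val-N r-prime e) (trans (cong (_+_ ((D ∸ sum e) * val r h₀))
                      (dot-zeroʳ e (map⁺ (All.map (λ h∈H → val-∤ r≥2 (r∤ h∈H)) hs⊆H)))) (ℕ.+-identityʳ _))

      N-injective : ∀ {e f} → e ∈ exponents n D → f ∈ exponents n D → N e ≡ N f → e ≡ f
      N-injective {e} {f} e∈ f∈ Ne≡Nf =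
        independent e f (|·|≡ (|e|≡n e∈)) (|·|≡ (|e|≡n f∈)) (All.tabulate λ {q} q∈Q → begin
        combination e (map vector hs) q     ≡⟨ combination-vector hs e q ⟩
        + dot e (map (val q) hs)            ≡⟨ cong +_ (dots-agree (∈Q⇒prime q∈Q)) ⟩
        + dot f (map (val q) hs)            ≡⟨ sym (combination-vector hs f q) ⟩
        combination f (map vector hs) q     ∎)
        where
        open ≡-Reasoning
        |·|≡ : ∀ {m} → m ≡ n → m ≡ length (map vector hs)
        |·|≡ m≡n = trans m≡n (sym (length-map vector hs))
        dots-agree : ∀ {q} → Prime q → dot e (map (val q) hs) ≡ dot f (map (val q) hs)
        dots-agree {q} q-prime = ℕ.+-cancelˡ-≡ ((D ∸ sum e) * val q h₀) _ _ (begin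
          (D ∸ sum e) * val q h₀ + dot e (map (val q) hs) ≡⟨ sym (val-N q-prime e) ⟩
          val q (N e)                                     ≡⟨ cong (val q) Ne≡Nf ⟩
          val q (N f)                                     ≡⟨ val-N q-prime f ⟩
          (D ∸ sum f) * val q h₀ + dot f (map (val q) hs) ≡⟨ cong (_+ dot f (map (val q) hs))
                                                                  (h₀-parts-agree {e} {f} Ne≡Nf q-prime) ⟨
          (D ∸ sum e) * val q h₀ + dot f (map (val q) hs) ∎)

      G%p-injective : ∀ {e f} → e ∈ exponents n D → f ∈ exponents n D → G e % p ≡ G f % p → e ≡ f
      G%p-injective e∈ f∈ Ge≡Gf = N-injective e∈ f∈ (≡±⇒≡ (2N<p e∈) (2N<p f∈)
        (≡±-trans (N≡±aᴰG e∈)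
          (≡±-trans (≡mod⇒≡± (%≡⇒≡mod (*-cong-% {m = a ^ D} refl Ge≡Gf))) (≡±-sym (N≡±aᴰG f∈)))))

      G%p-unity : ∀ e → ((G e % p) ^ t) % p ≡ 1 % p
      G%p-unity e = trans (^-cong-% t (m%n%n≡m%n (G e) p))
                          (monomial-unity {t = t} (±∈aG.gᵗ≡1 h₀-rep ∷ gs-of-unity hs⊆H) (homogenise D e))

      binomial≤t : (D + n) C n ≤ t
      binomial≤t = begin
        (D + n) C n                          ≡⟨ sym (length-exponents n D) ⟩
        length (exponents n D)               ≡⟨ sym (length-map residue (exponents n D)) ⟩
        length (map residue (exponents n D)) ≤⟨ unityRoots≤ p-prime 0<t _ residues-unique
                                                  (map⁺ (All.tabulate λ {e} _ → m%n<n (G e) p))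
                                                  (map⁺ (All.tabulate λ {e} _ → G%p-unity e)) ⟩
        t                                    ∎
        where
        open ℕ.≤-Reasoning
        residue : List ℕ → ℕ
        residue e = G e % p
        residues-unique = Unique-map⁺ residue G%p-injective (exponents-unique n D)

    independent⇒binomial≤t : ∀ {s B} → length B ≡ suc s → All (_∈ map vector H) B → Independent Q B →
                             (D + suc s) C suc s ≤ t
    independent⇒binomial≤t |B|≡1+s B⊆ independent with hs , refl , hs⊆H ← map-preimage vector _ B⊆ =
      subst (λ m → (D + m) C m ≤ t) (trans (sym (length-map vector hs)) |B|≡1+s)
        (IndependentFamily.binomial≤t hs⊆H independent)

    coprimeHeights≤Ψ : ∀ {s} → (∀ s′ → (D + s′) C s′ ≤ t → s′ ≤ s) → length H ≤ Ψ k (nthPrime s)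
    coprimeHeights≤Ψ {s} s-maximal with elimination Q s (map vector H)
    ... | inj₁ (J , |J|≤s , J⊆Q , determined) = determined⇒length≤Ψ |J|≤s J⊆Q determined
    ... | inj₂ (B , |B|≡1+s , B⊆ , independent) =
      ⊥-elim (ℕ.1+n≰n (s-maximal (suc s) (independent⇒binomial≤t |B|≡1+s B⊆ independent)))

open import Data.Bool using (T)
open import Data.Nat using (ℕ; suc; _+_; _*_; _∸_; _^_; _≤_; _<_; NonZero)
open import Data.Nat.Divisibility using (_∣_)
open import Data.Nat.Primality using (Prime)
open import Data.Nat.Combinatorics using (_C_)
open import Data.List using (length)
open import Defs
open Heights using (inUᵇ⇒InU)
open Bound using (coprimeHeights≤Ψ)

theorem1p2 : (p : ℕ) → .{{_ : NonZero p}} → Prime p → 2 < p →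
    (t : ℕ) → 0 < t → t ∣ p ∸ 1 →
    (k : ℕ) → 1 < k → 2 * k < p →
    (a : ℕ) → 0 < a → a < p →
    (x0 : ℕ) → x0 < p → T (inUᵇ p k t a x0) →
    -- r0 = ⌊ log(p/2) / log k ⌋ , i.e. the largest r with k^r ≤ p/2
    (r0 : ℕ) → 2 * k ^ r0 ≤ p → p < 2 * k ^ suc r0 →
    -- s = max { s' ≥ 0 : C(r0+s', s') ≤ t }
    (s : ℕ) → (r0 + s) C s ≤ t → (∀ s' → (r0 + s') C s' ≤ t → s' ≤ s) →
    length (coprimeHeights p k t a x0) ≤ Ψ k (nthPrime s)
theorem1p2 p p-prime 2<p t 0<t _ k 1<k _ a 0<a a<p x0 x0<p x0∈U r0 2kʳ⁰≤p _ s _ s-maximal =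
  coprimeHeights≤Ψ p p-prime 2<p 0<t 1<k 0<a a<p x0<p (inUᵇ⇒InU p x0∈U) 2kʳ⁰≤p s-maximal
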